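{- Let $(L,\rhd)$ be a complete left pre-Lie algebra over a field of characteristic zero and $x\in L$. Then \[ \log_\rhd(1+x)=\sum_T\Big(\prod_{b\in B_r(T)}\frac{B_{l(b)}}{l(b)!}\Big)T_\rhd(x), \] the sum running over all planar binary rooted trees $T$.
   Context: A complete left pre-Lie algebra is a vector space $L$ with a bilinear product $\rhd$ whose associator $x\rhd(y\rhd z)-(x\rhd y)\rhd z$ is symmetric in $x,y$, and a complete decreasing filtration $L=F^1L\supset F^2L\supset\cdots$ with $F^pL\rhd F^qL\subset F^{p+q}L$. $\log_\rhd(1+x)$ is the unique $y\in L$ with $\sum_{k\ge1}\frac1{k!}y\rhd(y\rhd(\cdots\rhd y))=x$ ($k$ factors). $B_k$ are the Bernoulli numbers, $\frac{t}{e^t-1}=\sum_k\frac{B_k}{k!}t^k$. Planar binary rooted trees have a univalent root; $|$ is the one-leaf tree and $T_1\vee T_2$ the tree whose root edge ends at an inner vertex with left subtree $T_1$ and right subtree $T_2$. $T_\rhd(x)$ is defined recursively by $|_\rhd(x)=x$ and $(T_1\vee T_2)_\rhd(x)=(T_1)_\rhd(x)\rhd(T_2)_\rhd(x)$. A right pointing branch of $T$ is, for each inner vertex $v$ that is either adjacent to the root edge or a left child, the path starting at $v$ and repeatedly passing to the right child until a leaf is reached; its length $l(b)$ is its number of edges. $B_r(T)$ is the set of right pointing branches (empty for $T=|$). -}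

module Defs where

open import Level using (Level; _⊔_) renaming (suc to lsuc)
open import Algebra.Bundles using (CommutativeRing)
open import Algebra.Module.Bundles using (Module)
open import Data.Nat using (ℕ; zero; suc; _≤_; _∸_; _!) renaming (_+_ to _+ℕ_)
open import Data.Nat.Properties using (_!≢0)
open import Data.Nat.Combinatorics using (_C_)
open import Data.Integer using (ℤ; +_; -[1+_])
open import Data.Rational as Q using (ℚ; mkℚ; 0ℚ; 1ℚ)
open import Data.List using (List; []; _∷_; _++_; concatMap; map; foldr; upTo; zip; product; sum)
import Data.Product
open import Data.Product using (Σ; _×_; _,_; ∃; ∃-syntax)
open import Relation.Nullary using (¬_)

record Field (c ℓ : Level) : Set (lsuc (c ⊔ ℓ)) where
  field
    commutativeRing : CommutativeRing c ℓ
  open CommutativeRing commutativeRing public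
  field
    0≉1     : ¬ (0# ≈ 1#)
    inv     : (x : Carrier) → ¬ (x ≈ 0#) → Carrier
    inverse : ∀ x (nz : ¬ (x ≈ 0#)) → (x * inv x nz) ≈ 1#

module _ {c ℓ} (F : Field c ℓ) where
  open Field F

  natK : ℕ → Carrier
  natK zero    = 0#
  natK (suc n) = 1# + natK n

  intK : ℤ → Carrier
  intK (+ n)      = natK n
  intK -[1+ n ]   = - natK (suc n)

  CharacteristicZero : Set ℓ
  CharacteristicZero = ∀ n → ¬ (natK (suc n) ≈ 0#)

  ratK : CharacteristicZero → ℚ → Carrier
  ratK ch0 (mkℚ p d _) = intK p * inv (natK (suc d)) (ch0 d)

-- Bernoulli numbers  t/(e^t - 1) = Σ B_k t^k / k!
-- (equivalently B_0 = 1, Σ_{k=0}^{n} C(n+1,k) B_k = 0 for n ≥ 1)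

ℕtoℚ : ℕ → ℚ
ℕtoℚ n = (+ n) Q./ 1

nextBernoulli : ℕ → List ℚ → ℚ
nextBernoulli zero    _    = 1ℚ
nextBernoulli (suc n) prev =
  Q.- ((+ 1 Q./ suc (suc n)) Q.*
     foldr Q._+_ 0ℚ (map (λ kb → ℕtoℚ (suc (suc n) C Data.Product.proj₁ kb) Q.* Data.Product.proj₂ kb)
                       (zip (upTo (suc n)) prev)))

-- [B_0, …, B_{n-1}]
bernoulliList : ℕ → List ℚ
bernoulliList zero    = []
bernoulliList (suc n) = bernoulliList n ++ (nextBernoulli n (bernoulliList n) ∷ [])

bernoulli : ℕ → ℚ
bernoulli n = nextBernoulli n (bernoulliList n)

bernoulliOverFact : ℕ → ℚ
bernoulliOverFact l = bernoulli l Q.* ((+ 1 Q./ (l !)) {{l !≢0}})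

infixr 5 _∨_
data Tree : Set where
  ∣    : Tree
  _∨_ : Tree → Tree → Tree

leaves : Tree → ℕ
leaves ∣       = 1
leaves (a ∨ b) = leaves a +ℕ leaves b

-- all trees with exactly n leaves (fuel-driven enumeration; fuel ≥ n suffices)
treesWith : ℕ → ℕ → List Tree
treesWith _        zero          = []
treesWith _        (suc zero)    = ∣ ∷ []
treesWith zero     (suc (suc n)) = []
treesWith (suc f)  (suc (suc n)) =
  concatMap (λ i → concatMap (λ a → map (λ b → a ∨ b) (treesWith f (suc (n ∸ i))))
                             (treesWith f (suc i)))
            (upTo (suc n))

treesOfSize : ℕ → List Tree
treesOfSize n = treesWith n n

treesUpTo : ℕ → List Tree
treesUpTo zero    = []
treesUpTo (suc n) = treesUpTo n ++ treesOfSize (suc n)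

rightLength : Tree → ℕ
rightLength ∣       = 0
rightLength (a ∨ b) = suc (rightLength b)

-- lengths l(b) of the right pointing branches: one for each inner vertex
-- that is adjacent to the root edge or is a left child.
mutual
  -- branches starting in T, where T's top vertex is root-adjacent or a left child
  branchLengths : Tree → List ℕ
  branchLengths ∣       = []
  branchLengths (a ∨ b) = rightLength (a ∨ b) ∷ (branchLengths a ++ rightChildBranches b)

  -- branches inside T, where T's top vertex is a right child (no branch starts there)
  rightChildBranches : Tree → List ℕ
  rightChildBranches ∣       = []
  rightChildBranches (a ∨ b) = branchLengths a ++ rightChildBranches b

treeCoefficient : Tree → ℚ
treeCoefficient T = foldr Q._*_ 1ℚ (map bernoulliOverFact (branchLengths T))

record CompletePreLie {c ℓ m ℓm} (F : Field c ℓ)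
         (M : Module (Field.commutativeRing F) m ℓm) (ℓf : Level)
         : Set (c ⊔ ℓ ⊔ m ⊔ ℓm ⊔ lsuc ℓf) where
  open Field F
  open Module M
  infixl 7 _▷_
  field
    _▷_        : Carrierᴹ → Carrierᴹ → Carrierᴹ
    ▷-cong     : ∀ {x x′ y y′} → x ≈ᴹ x′ → y ≈ᴹ y′ → (x ▷ y) ≈ᴹ (x′ ▷ y′)
    ▷-distribˡ : ∀ x y z → (x ▷ (y +ᴹ z)) ≈ᴹ ((x ▷ y) +ᴹ (x ▷ z))
    ▷-distribʳ : ∀ x y z → ((y +ᴹ z) ▷ x) ≈ᴹ ((y ▷ x) +ᴹ (z ▷ x))
    ▷-scalarˡ  : ∀ (r : Carrier) x y → ((r *ₗ x) ▷ y) ≈ᴹ (r *ₗ (x ▷ y))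
    ▷-scalarʳ  : ∀ (r : Carrier) x y → (x ▷ (r *ₗ y)) ≈ᴹ (r *ₗ (x ▷ y))
    preLie     : ∀ x y z → ((x ▷ (y ▷ z)) +ᴹ (-ᴹ ((x ▷ y) ▷ z)))
                             ≈ᴹ ((y ▷ (x ▷ z)) +ᴹ (-ᴹ ((y ▷ x) ▷ z)))
    Fil        : ℕ → Carrierᴹ → Set ℓf
    Fil-resp   : ∀ {p x y} → x ≈ᴹ y → Fil p x → Fil p y
    Fil-0      : ∀ p → Fil p 0ᴹ
    Fil-+      : ∀ {p x y} → Fil p x → Fil p y → Fil p (x +ᴹ y)
    Fil-*ₗ     : ∀ {p x} (r : Carrier) → Fil p x → Fil p (r *ₗ x)
    Fil-1      : ∀ x → Fil 1 x
    Fil-dec    : ∀ {p x} → Fil (suc p) x → Fil p x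
    Fil-▷      : ∀ {p q x y} → Fil p x → Fil q y → Fil (p +ℕ q) (x ▷ y)
    separated  : ∀ {x} → (∀ p → Fil p x) → x ≈ᴹ 0ᴹ
    complete   : ∀ (s : ℕ → Carrierᴹ) →
                 (∀ p → ∃[ N ] ∀ n k → N ≤ n → N ≤ k → Fil p (s n +ᴹ (-ᴹ s k))) →
                 ∃[ l ] ∀ p → ∃[ N ] ∀ n → N ≤ n → Fil p (s n +ᴹ (-ᴹ l))

module PreLieOps {c ℓ m ℓm ℓf} (F : Field c ℓ) (ch0 : CharacteristicZero F)
         (M : Module (Field.commutativeRing F) m ℓm) (L : CompletePreLie F M ℓf) where
  open Field F
  open Module M
  open CompletePreLie L

  ConvergesTo : (ℕ → Carrierᴹ) → Carrierᴹ → Set ℓf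
  ConvergesTo s l = ∀ p → ∃[ N ] ∀ n → N ≤ n → Fil p (s n +ᴹ (-ᴹ l))

  sumᴹ : List Carrierᴹ → Carrierᴹ
  sumᴹ = foldr _+ᴹ_ 0ᴹ

  -- y ▷ (y ▷ (⋯ ▷ y)) with (suc k) factors
  rightPower : Carrierᴹ → ℕ → Carrierᴹ
  rightPower y zero    = y
  rightPower y (suc k) = y ▷ rightPower y k

  -- Σ_{k=1}^{n+1} (1/k!) y ▷ (y ▷ (⋯ ▷ y))   (k factors)
  expPartial : Carrierᴹ → ℕ → Carrierᴹ
  expPartial y n =
    sumᴹ (map (λ k → ratK F ch0 ((+ 1 Q./ (suc k !)) {{suc k !≢0}}) *ₗ rightPower y k) (upTo (suc n)))

  -- y = log_▷(1 + x)  :⇔  Σ_{k≥1} (1/k!) y▷(y▷(⋯▷y)) = x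
  IsLog : Carrierᴹ → Carrierᴹ → Set ℓf
  IsLog x y = ConvergesTo (expPartial y) x

  evalTree : Tree → Carrierᴹ → Carrierᴹ
  evalTree ∣       x = x
  evalTree (a ∨ b) x = evalTree a x ▷ evalTree b x

  treeSeriesPartial : Carrierᴹ → ℕ → Carrierᴹ
  treeSeriesPartial x n =
    sumᴹ (map (λ T → ratK F ch0 (treeCoefficient T) *ₗ evalTree T x) (treesUpTo n))

-- Weight each tree T by an arbitrary function φ of the length of its root branch (the right pointing
-- branch starting at the root), keeping the factors B_l/l! of all its other branches; call the resulting
-- series W(φ). The tree series S is W(B_l/l!), and splitting trees at the root gives
-- W(φ) = φ(0) x + S ▷ W(φ(· + 1)). Hence S ▷ (S ▷ ⋯ ▷ S) with k + 1 factors is W of B_l/l! shifted by k,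
-- and Σ_k S^{▷(k+1)}/(k+1)! is W(δ₀) = x by the Bernoulli identity Σ_{k ≤ m} B_{m-k}/((k+1)!(m-k)!) = δ_{m,0}.
-- All of this holds modulo F^p for sums truncated at p leaves; completeness yields the limit, and the
-- logarithm is unique by induction on the filtration degree.

module Submission where

open import Defs
open import Level using (Level)
open import Algebra.Module.Bundles using (Module)
open import Data.Product using (_×_; ∃; _,_; proj₁; proj₂)
open import Algebra.Bundles using (CommutativeMonoid; CommutativeRing)
open import Data.Nat as ℕ using (ℕ; zero; suc; _!; _≤_; _<_; _∸_; z≤n; s≤s; _⊔_)
  renaming (_+_ to _+ℕ_; _*_ to _*ℕ_)
import Data.Nat.Properties as ℕP
open import Data.Nat.Combinatorics using (_C_; nCk≡n!/k![n-k]!; k![n∸k]!∣n!; nCk≡nC[n∸k]; nC1≡n)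
open import Data.Nat.DivMod using (m/n*n≡m)
open import Data.Integer as ℤ using (ℤ; +_; -[1+_])
import Data.Integer.Properties as ℤP
open import Data.Sign as Sign using (Sign)
open import Data.Rational as Q using (ℚ; mkℚ)
import Data.Rational.Properties as QP
open import Data.Rational.Unnormalised as Qᵘ using (ℚᵘ; mkℚᵘ; *≡*)
open import Data.List using (List; []; _∷_; _++_; map; foldr; upTo; zip; concat; concatMap)
import Data.List.Properties as LP
open import Data.List.Relation.Unary.All as All using (All; []; _∷_)
import Data.List.Relation.Unary.All.Properties as AllP
open import Data.Maybe using (Maybe; just; nothing)
open import Function using (_∘_)
open import Relation.Nullary using (¬_; yes; no)
open import Relation.Binary.PropositionalEquality as P using (_≡_)
import Algebra.Solver.Ring
import Algebra.Solver.Ring.AlmostCommutativeRing as ACR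
import Algebra.Properties.AbelianGroup as AbelianGroupProperties
import Algebra.Properties.CommutativeSemigroup as CommutativeSemigroupProperties
import Algebra.Properties.Group as GroupProperties
import Algebra.Properties.Ring as RingProperties
open import Relation.Binary.Bundles using (Setoid)
import Relation.Binary.Reasoning.Setoid

module FiniteSums {c ℓ} (CM : CommutativeMonoid c ℓ) where
  open CommutativeMonoid CM renaming (Carrier to A)
  open CommutativeSemigroupProperties commutativeSemigroup public using (interchange)
  open import Relation.Binary.Reasoning.Setoid setoid

  Σ< : ℕ → (ℕ → A) → A
  Σ< zero    f = ε
  Σ< (suc n) f = Σ< n f ∙ f n

  Σ<-cong : ∀ n {f g} → (∀ i → i < n → f i ≈ g i) → Σ< n f ≈ Σ< n g
  Σ<-cong zero    f≈g = refl
  Σ<-cong (suc n) f≈g = ∙-cong (Σ<-cong n (λ i i<n → f≈g i (ℕP.m<n⇒m<1+n i<n))) (f≈g n ℕP.≤-refl)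

  Σ<-cong′ : ∀ n {f g} → (∀ i → f i ≈ g i) → Σ< n f ≈ Σ< n g
  Σ<-cong′ n f≈g = Σ<-cong n (λ i _ → f≈g i)

  Σ<-distrib : ∀ n f g → Σ< n (λ i → f i ∙ g i) ≈ Σ< n f ∙ Σ< n g
  Σ<-distrib zero    f g = sym (identityˡ ε)
  Σ<-distrib (suc n) f g = trans (∙-congʳ (Σ<-distrib n f g)) (interchange _ _ _ _)

  Σ<-ε : ∀ n {f} → (∀ i → i < n → f i ≈ ε) → Σ< n f ≈ ε
  Σ<-ε n {f} f≈ε = trans (Σ<-cong n f≈ε) (Σ<-const n)
    where
    Σ<-const : ∀ n → Σ< n (λ _ → ε) ≈ ε
    Σ<-const zero    = refl
    Σ<-const (suc n) = trans (identityʳ _) (Σ<-const n)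

  Σ<-cons : ∀ n f → Σ< (suc n) f ≈ f 0 ∙ Σ< n (λ i → f (suc i))
  Σ<-cons zero    f = trans (identityˡ _) (sym (identityʳ _))
  Σ<-cons (suc n) f = begin
    Σ< (suc n) f ∙ f (suc n)                   ≈⟨ ∙-congʳ (Σ<-cons n f) ⟩
    (f 0 ∙ Σ< n (λ i → f (suc i))) ∙ f (suc n) ≈⟨ assoc _ _ _ ⟩
    f 0 ∙ (Σ< n (λ i → f (suc i)) ∙ f (suc n)) ∎

  Σ<-reverse : ∀ n f → Σ< n (λ i → f (n ∸ suc i)) ≈ Σ< n f
  Σ<-reverse zero    f = refl
  Σ<-reverse (suc n) f = begin
    Σ< n (λ i → f (suc n ∸ suc i)) ∙ f (n ∸ n)
      ≈⟨ ∙-cong (Σ<-cong n (λ i i<n → reflexive (P.cong f (ℕP.+-∸-assoc 1 i<n))))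
                (reflexive (P.cong f (ℕP.n∸n≡0 n))) ⟩
    Σ< n (λ i → f (suc (n ∸ suc i))) ∙ f 0     ≈⟨ comm _ _ ⟩
    f 0 ∙ Σ< n (λ i → f (suc (n ∸ suc i)))     ≈⟨ ∙-congˡ (Σ<-reverse n (λ i → f (suc i))) ⟩
    f 0 ∙ Σ< n (λ i → f (suc i))               ≈⟨ sym (Σ<-cons n f) ⟩
    Σ< (suc n) f                               ∎

  Σ<-split : ∀ n k f → Σ< (n +ℕ k) f ≈ Σ< n f ∙ Σ< k (λ i → f (n +ℕ i))
  Σ<-split n zero    f = trans (reflexive (P.cong (λ m → Σ< m f) (ℕP.+-identityʳ n))) (sym (identityʳ _))
  Σ<-split n (suc k) f = begin
    Σ< (n +ℕ suc k) f                               ≡⟨ P.cong (λ m → Σ< m f) (ℕP.+-suc n k) ⟩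
    Σ< (n +ℕ k) f ∙ f (n +ℕ k)                      ≈⟨ ∙-congʳ (Σ<-split n k f) ⟩
    (Σ< n f ∙ Σ< k (λ i → f (n +ℕ i))) ∙ f (n +ℕ k) ≈⟨ assoc _ _ _ ⟩
    Σ< n f ∙ Σ< (suc k) (λ i → f (n +ℕ i))          ∎

  sumL : List A → A
  sumL = foldr _∙_ ε

  sumL-++ : ∀ xs ys → sumL (xs ++ ys) ≈ sumL xs ∙ sumL ys
  sumL-++ []       ys = sym (identityˡ _)
  sumL-++ (x ∷ xs) ys = trans (∙-congˡ (sumL-++ xs ys)) (sym (assoc _ _ _))

  sumL-upTo : ∀ n f → sumL (map f (upTo n)) ≈ Σ< n f
  sumL-upTo zero    f = refl
  sumL-upTo (suc n) f = begin
    sumL (map f (upTo (suc n)))        ≡⟨ P.cong (λ l → sumL (map f l)) (P.sym (LP.upTo-∷ʳ n)) ⟩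
    sumL (map f (upTo n ++ n ∷ []))    ≡⟨ P.cong sumL (LP.map-++ f (upTo n) (n ∷ [])) ⟩
    sumL (map f (upTo n) ++ f n ∷ [])  ≈⟨ sumL-++ (map f (upTo n)) (f n ∷ []) ⟩
    sumL (map f (upTo n)) ∙ (f n ∙ ε)  ≈⟨ ∙-cong (sumL-upTo n f) (identityʳ _) ⟩
    Σ< n f ∙ f n                       ∎

module RationalEmbedding {c ℓ} (F : Field c ℓ) (ch0 : CharacteristicZero F) where
  open Field F
  open import Relation.Binary.Reasoning.Setoid setoid
  open RingProperties ring using (-‿distribˡ-*)
  open GroupProperties +-group using (⁻¹-involutive; ε⁻¹≈ε)
  open AbelianGroupProperties +-abelianGroup using (⁻¹-∙-comm)

  fromℕ : ℕ → Carrier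
  fromℕ = natK F

  fromℤ : ℤ → Carrier
  fromℤ = intK F

  fromℚ : ℚ → Carrier
  fromℚ = ratK F ch0

  fromℕ-homo-+ : ∀ m n → fromℕ (m +ℕ n) ≈ fromℕ m + fromℕ n
  fromℕ-homo-+ zero    n = sym (+-identityˡ _)
  fromℕ-homo-+ (suc m) n = trans (+-congˡ (fromℕ-homo-+ m n)) (sym (+-assoc _ _ _))

  fromℕ-homo-* : ∀ m n → fromℕ (m *ℕ n) ≈ fromℕ m * fromℕ n
  fromℕ-homo-* zero    n = sym (zeroˡ _)
  fromℕ-homo-* (suc m) n = begin
    fromℕ (n +ℕ m *ℕ n)                  ≈⟨ fromℕ-homo-+ n (m *ℕ n) ⟩
    fromℕ n + fromℕ (m *ℕ n)             ≈⟨ +-cong (sym (*-identityˡ _)) (fromℕ-homo-* m n) ⟩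
    1# * fromℕ n + fromℕ m * fromℕ n     ≈⟨ sym (distribʳ _ _ _) ⟩
    (1# + fromℕ m) * fromℕ n             ∎

  fromℤ-homo‿- : ∀ i → fromℤ (ℤ.- i) ≈ - fromℤ i
  fromℤ-homo‿- -[1+ n ]   = sym (⁻¹-involutive _)
  fromℤ-homo‿- (+ zero)   = sym ε⁻¹≈ε
  fromℤ-homo‿- (+ suc n)  = refl

  fromℤ-homo-⊖ : ∀ m n → fromℤ (m ℤ.⊖ n) ≈ fromℕ m + - fromℕ n
  fromℤ-homo-⊖ m n with n ℕ.≤? m
  ... | yes n≤m = begin
    fromℤ (m ℤ.⊖ n)                             ≡⟨ P.cong fromℤ (ℤP.⊖-≥ n≤m) ⟩
    fromℕ (m ∸ n)                               ≈⟨ sym (shift (fromℕ-homo-+ (m ∸ n) n)) ⟩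
    fromℕ (m ∸ n +ℕ n) + - fromℕ n              ≡⟨ P.cong (λ k → fromℕ k + - fromℕ n) (ℕP.m∸n+n≡m n≤m) ⟩
    fromℕ m + - fromℕ n                         ∎
    where
    shift : ∀ {a b d} → a ≈ b + d → a + - d ≈ b
    shift {a} {b} {d} a≈b+d = begin
      a + - d         ≈⟨ +-congʳ a≈b+d ⟩
      b + d + - d     ≈⟨ +-assoc _ _ _ ⟩
      b + (d + - d)   ≈⟨ +-congˡ (-‿inverseʳ d) ⟩
      b + 0#          ≈⟨ +-identityʳ b ⟩
      b               ∎
  ... | no n≰m = begin
    fromℤ (m ℤ.⊖ n)                             ≡⟨ P.cong fromℤ (ℤP.⊖-< n>m) ⟩
    fromℤ (ℤ.- (+ (n ∸ m)))                     ≈⟨ fromℤ-homo‿- (+ (n ∸ m)) ⟩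
    - fromℕ (n ∸ m)                             ≈⟨ sym (+-identityˡ _) ⟩
    0# + - fromℕ (n ∸ m)                        ≈⟨ +-congʳ (sym (-‿inverseʳ (fromℕ m))) ⟩
    fromℕ m + - fromℕ m + - fromℕ (n ∸ m)       ≈⟨ +-assoc _ _ _ ⟩
    fromℕ m + (- fromℕ m + - fromℕ (n ∸ m))     ≈⟨ +-congˡ (⁻¹-∙-comm _ _) ⟩
    fromℕ m + - (fromℕ m + fromℕ (n ∸ m))       ≈⟨ +-congˡ (-‿cong (sym (fromℕ-homo-+ m (n ∸ m)))) ⟩
    fromℕ m + - fromℕ (m +ℕ (n ∸ m))            ≡⟨ P.cong (λ k → fromℕ m + - fromℕ k) (ℕP.m+[n∸m]≡n (ℕP.<⇒≤ n>m)) ⟩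
    fromℕ m + - fromℕ n                         ∎
    where
    n>m : m < n
    n>m = ℕP.≰⇒> n≰m

  fromℤ-homo-+ : ∀ i j → fromℤ (i ℤ.+ j) ≈ fromℤ i + fromℤ j
  fromℤ-homo-+ -[1+ m ] -[1+ n ] = begin
    - fromℕ (suc (suc (m +ℕ n)))       ≡⟨ P.cong (λ k → - fromℕ (suc k)) (P.sym (ℕP.+-suc m n)) ⟩
    - fromℕ (suc m +ℕ suc n)           ≈⟨ -‿cong (fromℕ-homo-+ (suc m) (suc n)) ⟩
    - (fromℕ (suc m) + fromℕ (suc n))  ≈⟨ sym (⁻¹-∙-comm _ _) ⟩
    - fromℕ (suc m) + - fromℕ (suc n)  ∎
  fromℤ-homo-+ -[1+ m ] (+ n)    = trans (fromℤ-homo-⊖ n (suc m)) (+-comm _ _)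
  fromℤ-homo-+ (+ m)    -[1+ n ] = fromℤ-homo-⊖ m (suc n)
  fromℤ-homo-+ (+ m)    (+ n)    = fromℕ-homo-+ m n

  fromSign : Sign → Carrier
  fromSign Sign.+ = 1#
  fromSign Sign.- = - 1#

  fromSign-homo-* : ∀ s t → fromSign (s Sign.* t) ≈ fromSign s * fromSign t
  fromSign-homo-* Sign.- Sign.- = sym (begin
    - 1# * - 1#     ≈⟨ sym (-‿distribˡ-* _ _) ⟩
    - (1# * - 1#)   ≈⟨ -‿cong (*-identityˡ _) ⟩
    - - 1#          ≈⟨ ⁻¹-involutive _ ⟩
    1#              ∎)
  fromSign-homo-* Sign.- Sign.+ = sym (*-identityʳ _)
  fromSign-homo-* Sign.+ Sign.- = sym (*-identityˡ _)
  fromSign-homo-* Sign.+ Sign.+ = sym (*-identityˡ _)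

  fromℤ-◃ : ∀ s n → fromℤ (s ℤ.◃ n) ≈ fromSign s * fromℕ n
  fromℤ-◃ s      zero    = sym (zeroʳ _)
  fromℤ-◃ Sign.+ (suc n) = sym (*-identityˡ _)
  fromℤ-◃ Sign.- (suc n) = trans (-‿cong (sym (*-identityˡ _))) (-‿distribˡ-* _ _)

  fromℤ-sign-abs : ∀ i → fromℤ i ≈ fromSign (ℤ.sign i) * fromℕ ℤ.∣ i ∣
  fromℤ-sign-abs -[1+ n ] = fromℤ-◃ Sign.- (suc n)
  fromℤ-sign-abs (+ n)    = sym (*-identityˡ _)

  fromℤ-homo-* : ∀ i j → fromℤ (i ℤ.* j) ≈ fromℤ i * fromℤ j
  fromℤ-homo-* i j = begin
    fromℤ (i ℤ.* j)
      ≈⟨ fromℤ-◃ (ℤ.sign i Sign.* ℤ.sign j) (ℤ.∣ i ∣ ℕ.* ℤ.∣ j ∣) ⟩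
    fromSign (ℤ.sign i Sign.* ℤ.sign j) * fromℕ (ℤ.∣ i ∣ ℕ.* ℤ.∣ j ∣)
      ≈⟨ *-cong (fromSign-homo-* (ℤ.sign i) (ℤ.sign j)) (fromℕ-homo-* ℤ.∣ i ∣ ℤ.∣ j ∣) ⟩
    (fromSign (ℤ.sign i) * fromSign (ℤ.sign j)) * (fromℕ ℤ.∣ i ∣ * fromℕ ℤ.∣ j ∣)
      ≈⟨ *-interchange _ _ _ _ ⟩
    (fromSign (ℤ.sign i) * fromℕ ℤ.∣ i ∣) * (fromSign (ℤ.sign j) * fromℕ ℤ.∣ j ∣)
      ≈⟨ sym (*-cong (fromℤ-sign-abs i) (fromℤ-sign-abs j)) ⟩
    fromℤ i * fromℤ j
      ∎
    where open CommutativeSemigroupProperties *-commutativeSemigroup renaming (interchange to *-interchange)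

  private
    ℤ-morphism : ACR._-Raw-AlmostCommutative⟶_
                   (CommutativeRing.rawRing ℤP.+-*-commutativeRing)
                   (ACR.fromCommutativeRing commutativeRing)
    ℤ-morphism = record
      { ⟦_⟧ = fromℤ ; +-homo = fromℤ-homo-+ ; *-homo = fromℤ-homo-* ; -‿homo = fromℤ-homo‿-
      ; 0-homo = refl ; 1-homo = +-identityʳ _ }

    ℤ-equal? : ∀ a b → Maybe (fromℤ a ≈ fromℤ b)
    ℤ-equal? a b with a ℤ.≟ b
    ... | yes P.refl = just refl
    ... | no _       = nothing

  module FieldSolver = Algebra.Solver.Ring _ (ACR.fromCommutativeRing commutativeRing) ℤ-morphism ℤ-equal?
  open FieldSolver using (solve; _:=_; _:+_; _:*_)

  inv-unique : ∀ {a b} a≉0 → a * b ≈ 1# → b ≈ inv a a≉0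
  inv-unique {a} {b} a≉0 ab≈1 = begin
    b                      ≈⟨ sym (*-identityʳ b) ⟩
    b * 1#                 ≈⟨ *-congˡ (sym (inverse a a≉0)) ⟩
    b * (a * inv a a≉0)    ≈⟨ solve 3 (λ a b i → b :* (a :* i) := (a :* b) :* i) refl a b (inv a a≉0) ⟩
    (a * b) * inv a a≉0    ≈⟨ *-congʳ ab≈1 ⟩
    1# * inv a a≉0         ≈⟨ *-identityˡ _ ⟩
    inv a a≉0              ∎

  *-cancelʳ-≈0 : ∀ {a x} → ¬ (a ≈ 0#) → x * a ≈ 0# → x ≈ 0#
  *-cancelʳ-≈0 {a} {x} a≉0 xa≈0 = begin
    x                    ≈⟨ sym (*-identityʳ x) ⟩
    x * 1#               ≈⟨ *-congˡ (sym (inverse a a≉0)) ⟩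
    x * (a * inv a a≉0)  ≈⟨ sym (*-assoc _ _ _) ⟩
    (x * a) * inv a a≉0  ≈⟨ *-congʳ xa≈0 ⟩
    0# * inv a a≉0       ≈⟨ zeroˡ _ ⟩
    0#                   ∎

  *-≉0 : ∀ {a b} → ¬ (a ≈ 0#) → ¬ (b ≈ 0#) → ¬ (a * b ≈ 0#)
  *-≉0 {a} {b} a≉0 b≉0 ab≈0 = b≉0 (*-cancelʳ-≈0 a≉0 (trans (*-comm _ _) ab≈0))

  inv-* : ∀ {a b} a≉0 b≉0 ab≉0 → inv (a * b) ab≉0 ≈ inv a a≉0 * inv b b≉0
  inv-* {a} {b} a≉0 b≉0 ab≉0 = sym (inv-unique ab≉0 (begin
    (a * b) * (inv a a≉0 * inv b b≉0)
      ≈⟨ solve 4 (λ a b x y → (a :* b) :* (x :* y) := (a :* x) :* (b :* y)) refl a b _ _ ⟩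
    (a * inv a a≉0) * (b * inv b b≉0)  ≈⟨ *-cong (inverse a a≉0) (inverse b b≉0) ⟩
    1# * 1#                            ≈⟨ *-identityˡ _ ⟩
    1#                                 ∎))

  inv-cong : ∀ {a b} a≉0 b≉0 → a ≈ b → inv a a≉0 ≈ inv b b≉0
  inv-cong {a} a≉0 b≉0 a≈b = inv-unique b≉0 (trans (*-congʳ (sym a≈b)) (inverse a a≉0))

  -- ratK factors through unnormalised rationals, where + and * have no gcd normalisation.
  private
    den : ℕ → Carrier
    den d = fromℕ (suc d)

    den⁻¹ : ℕ → Carrier
    den⁻¹ d = inv (den d) (ch0 d)

    den*den⁻¹ : ∀ d → den d * den⁻¹ d ≈ 1#
    den*den⁻¹ d = inverse (den d) (ch0 d)

    den⁻¹-homo-* : ∀ d e → den⁻¹ (ℕ.pred (suc d *ℕ suc e)) ≈ den⁻¹ d * den⁻¹ e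
    den⁻¹-homo-* d e = begin
      inv (fromℕ (suc d *ℕ suc e)) _  ≈⟨ inv-cong _ (*-≉0 (ch0 d) (ch0 e)) (fromℕ-homo-* (suc d) (suc e)) ⟩
      inv (den d * den e) _           ≈⟨ inv-* (ch0 d) (ch0 e) _ ⟩
      den⁻¹ d * den⁻¹ e               ∎

    fromℚᵘ : ℚᵘ → Carrier
    fromℚᵘ (mkℚᵘ p d) = fromℤ p * den⁻¹ d

    fromℚ≈fromℚᵘ : ∀ q → fromℚ q ≈ fromℚᵘ (Q.toℚᵘ q)
    fromℚ≈fromℚᵘ (mkℚ _ _ _) = refl

    fromℚᵘ-cong : ∀ {p q} → p Qᵘ.≃ q → fromℚᵘ p ≈ fromℚᵘ q
    fromℚᵘ-cong {mkℚᵘ a d} {mkℚᵘ b e} (*≡* ae≡bd) = begin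
      fromℤ a * den⁻¹ d                                  ≈⟨ sym (*-identityʳ _) ⟩
      fromℤ a * den⁻¹ d * 1#                             ≈⟨ *-congˡ (sym (den*den⁻¹ e)) ⟩
      fromℤ a * den⁻¹ d * (den e * den⁻¹ e)
        ≈⟨ solve 4 (λ a x v y → a :* x :* (v :* y) := (a :* v) :* x :* y) refl (fromℤ a) (den⁻¹ d) (den e) (den⁻¹ e) ⟩
      (fromℤ a * den e) * den⁻¹ d * den⁻¹ e              ≈⟨ *-congʳ (*-congʳ cross) ⟩
      (fromℤ b * den d) * den⁻¹ d * den⁻¹ e
        ≈⟨ solve 4 (λ b u x y → (b :* u) :* x :* y := b :* y :* (u :* x)) refl (fromℤ b) (den d) (den⁻¹ d) (den⁻¹ e) ⟩
      fromℤ b * den⁻¹ e * (den d * den⁻¹ d)              ≈⟨ *-congˡ (den*den⁻¹ d) ⟩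
      fromℤ b * den⁻¹ e * 1#                             ≈⟨ *-identityʳ _ ⟩
      fromℤ b * den⁻¹ e                                  ∎
      where
      cross : fromℤ a * den e ≈ fromℤ b * den d
      cross = trans (sym (fromℤ-homo-* a (+ suc e)))
                    (trans (reflexive (P.cong fromℤ ae≡bd)) (fromℤ-homo-* b (+ suc d)))

    fromℚᵘ-homo-+ : ∀ p q → fromℚᵘ (p Qᵘ.+ q) ≈ fromℚᵘ p + fromℚᵘ q
    fromℚᵘ-homo-+ (mkℚᵘ a d) (mkℚᵘ b e) = begin
      fromℤ (a ℤ.* (+ suc e) ℤ.+ b ℤ.* (+ suc d)) * den⁻¹ (ℕ.pred (suc d *ℕ suc e))
        ≈⟨ *-cong (trans (fromℤ-homo-+ (a ℤ.* (+ suc e)) (b ℤ.* (+ suc d)))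
                         (+-cong (fromℤ-homo-* a (+ suc e)) (fromℤ-homo-* b (+ suc d))))
                  (den⁻¹-homo-* d e) ⟩
      (fromℤ a * den e + fromℤ b * den d) * (den⁻¹ d * den⁻¹ e)
        ≈⟨ solve 6 (λ a b x y u v → (a :* v :+ b :* u) :* (x :* y) := a :* x :* (v :* y) :+ b :* y :* (u :* x))
                   refl (fromℤ a) (fromℤ b) (den⁻¹ d) (den⁻¹ e) (den d) (den e) ⟩
      fromℤ a * den⁻¹ d * (den e * den⁻¹ e) + fromℤ b * den⁻¹ e * (den d * den⁻¹ d)
        ≈⟨ +-cong (trans (*-congˡ (den*den⁻¹ e)) (*-identityʳ _)) (trans (*-congˡ (den*den⁻¹ d)) (*-identityʳ _)) ⟩
      fromℤ a * den⁻¹ d + fromℤ b * den⁻¹ e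
        ∎

    fromℚᵘ-homo-* : ∀ p q → fromℚᵘ (p Qᵘ.* q) ≈ fromℚᵘ p * fromℚᵘ q
    fromℚᵘ-homo-* (mkℚᵘ a d) (mkℚᵘ b e) = begin
      fromℤ (a ℤ.* b) * den⁻¹ (ℕ.pred (suc d *ℕ suc e))  ≈⟨ *-cong (fromℤ-homo-* a b) (den⁻¹-homo-* d e) ⟩
      (fromℤ a * fromℤ b) * (den⁻¹ d * den⁻¹ e)
        ≈⟨ solve 4 (λ a b x y → (a :* b) :* (x :* y) := (a :* x) :* (b :* y)) refl _ _ _ _ ⟩
      fromℤ a * den⁻¹ d * (fromℤ b * den⁻¹ e)             ∎

    fromℚᵘ-homo‿- : ∀ p → fromℚᵘ (Qᵘ.- p) ≈ - fromℚᵘ p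
    fromℚᵘ-homo‿- (mkℚᵘ a d) = trans (*-congʳ (fromℤ-homo‿- a)) (sym (-‿distribˡ-* _ _))

  fromℚ-homo-+ : ∀ p q → fromℚ (p Q.+ q) ≈ fromℚ p + fromℚ q
  fromℚ-homo-+ p q = begin
    fromℚ (p Q.+ q)                        ≈⟨ fromℚ≈fromℚᵘ (p Q.+ q) ⟩
    fromℚᵘ (Q.toℚᵘ (p Q.+ q))              ≈⟨ fromℚᵘ-cong (QP.toℚᵘ-homo-+ p q) ⟩
    fromℚᵘ (Q.toℚᵘ p Qᵘ.+ Q.toℚᵘ q)        ≈⟨ fromℚᵘ-homo-+ (Q.toℚᵘ p) (Q.toℚᵘ q) ⟩
    fromℚᵘ (Q.toℚᵘ p) + fromℚᵘ (Q.toℚᵘ q)  ≈⟨ sym (+-cong (fromℚ≈fromℚᵘ p) (fromℚ≈fromℚᵘ q)) ⟩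
    fromℚ p + fromℚ q                      ∎

  fromℚ-homo-* : ∀ p q → fromℚ (p Q.* q) ≈ fromℚ p * fromℚ q
  fromℚ-homo-* p q = begin
    fromℚ (p Q.* q)                        ≈⟨ fromℚ≈fromℚᵘ (p Q.* q) ⟩
    fromℚᵘ (Q.toℚᵘ (p Q.* q))              ≈⟨ fromℚᵘ-cong (QP.toℚᵘ-homo-* p q) ⟩
    fromℚᵘ (Q.toℚᵘ p Qᵘ.* Q.toℚᵘ q)        ≈⟨ fromℚᵘ-homo-* (Q.toℚᵘ p) (Q.toℚᵘ q) ⟩
    fromℚᵘ (Q.toℚᵘ p) * fromℚᵘ (Q.toℚᵘ q)  ≈⟨ sym (*-cong (fromℚ≈fromℚᵘ p) (fromℚ≈fromℚᵘ q)) ⟩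
    fromℚ p * fromℚ q                      ∎

  fromℚ-homo‿- : ∀ p → fromℚ (Q.- p) ≈ - fromℚ p
  fromℚ-homo‿- p = begin
    fromℚ (Q.- p)                ≈⟨ fromℚ≈fromℚᵘ (Q.- p) ⟩
    fromℚᵘ (Q.toℚᵘ (Q.- p))      ≈⟨ fromℚᵘ-cong (QP.toℚᵘ-homo‿- p) ⟩
    fromℚᵘ (Qᵘ.- Q.toℚᵘ p)       ≈⟨ fromℚᵘ-homo‿- (Q.toℚᵘ p) ⟩
    - fromℚᵘ (Q.toℚᵘ p)          ≈⟨ -‿cong (sym (fromℚ≈fromℚᵘ p)) ⟩
    - fromℚ p                    ∎

  fromℚ-/ : ∀ i d → fromℚ (i Q./ suc d) ≈ fromℤ i * den⁻¹ d
  fromℚ-/ i d = trans (fromℚ≈fromℚᵘ (i Q./ suc d)) (fromℚᵘ-cong (QP.toℚᵘ-fromℚᵘ (mkℚᵘ i d)))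

  fromℚ-0 : fromℚ Q.0ℚ ≈ 0#
  fromℚ-0 = zeroˡ _

  fromℚ-1 : fromℚ Q.1ℚ ≈ 1#
  fromℚ-1 = den*den⁻¹ 0

  fromℚ-ℕ : ∀ n → fromℚ (ℕtoℚ n) ≈ fromℕ n
  fromℚ-ℕ n = begin
    fromℚ (ℕtoℚ n)         ≈⟨ fromℚ-/ (+ n) 0 ⟩
    fromℕ n * den⁻¹ 0      ≈⟨ *-congˡ (sym (*-identityˡ _)) ⟩
    fromℕ n * (1# * den⁻¹ 0) ≈⟨ *-congˡ (*-congʳ (sym (+-identityʳ 1#))) ⟩
    fromℕ n * (den 0 * den⁻¹ 0) ≈⟨ *-congˡ (den*den⁻¹ 0) ⟩
    fromℕ n * 1#           ≈⟨ *-identityʳ _ ⟩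
    fromℕ n                ∎

  fromℚ-1/n*n : ∀ n {{_ : ℕ.NonZero n}} → fromℚ (+ 1 Q./ n) * fromℕ n ≈ 1#
  fromℚ-1/n*n (suc d) = begin
    fromℚ (+ 1 Q./ suc d) * den d    ≈⟨ *-congʳ (fromℚ-/ (+ 1) d) ⟩
    (fromℤ (+ 1) * den⁻¹ d) * den d  ≈⟨ *-congʳ (trans (*-congʳ (+-identityʳ 1#)) (*-identityˡ _)) ⟩
    den⁻¹ d * den d                  ≈⟨ *-comm _ _ ⟩
    den d * den⁻¹ d                  ≈⟨ den*den⁻¹ d ⟩
    1#                               ∎

  fromℕ-≉0 : ∀ n {{_ : ℕ.NonZero n}} → ¬ (fromℕ n ≈ 0#)
  fromℕ-≉0 (suc n) = ch0 n

nCk*[k!*[n∸k]!]≡n! : ∀ {n k} → k ≤ n → (n C k) *ℕ (k ! *ℕ (n ∸ k) !) ≡ n !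
nCk*[k!*[n∸k]!]≡n! {n} {k} k≤n =
  P.trans (P.cong (_*ℕ (k ! *ℕ (n ∸ k) !)) (nCk≡n!/k![n-k]! k≤n))
          (m/n*n≡m {{ℕP._!*_!≢0 k (n ∸ k)}} (k![n∸k]!∣n! k≤n))

bernoulliList≡map : ∀ k → bernoulliList k ≡ map bernoulli (upTo k)
bernoulliList≡map zero    = P.refl
bernoulliList≡map (suc k) = begin
  bernoulliList k ++ (bernoulli k ∷ [])             ≡⟨ P.cong (_++ (bernoulli k ∷ [])) (bernoulliList≡map k) ⟩
  map bernoulli (upTo k) ++ map bernoulli (k ∷ [])  ≡⟨ P.sym (LP.map-++ bernoulli (upTo k) (k ∷ [])) ⟩
  map bernoulli (upTo k ++ k ∷ [])                  ≡⟨ P.cong (map bernoulli) (LP.upTo-∷ʳ k) ⟩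
  map bernoulli (upTo (suc k))                      ∎
  where open P.≡-Reasoning

zip-map : ∀ {A B : Set} (f : A → B) (xs : List A) → zip xs (map f xs) ≡ map (λ x → x , f x) xs
zip-map f []       = P.refl
zip-map f (x ∷ xs) = P.cong ((x , f x) ∷_) (zip-map f xs)

module BernoulliIdentity {c ℓ} (F : Field c ℓ) (ch0 : CharacteristicZero F) where
  open Field F
  open RationalEmbedding F ch0
  open FiniteSums +-commutativeMonoid
  open import Relation.Binary.Reasoning.Setoid setoid
  open FieldSolver using (solve; _:=_; _:+_; _:*_; :-_)

  expCoeff : ℕ → Carrier
  expCoeff k = fromℚ ((+ 1 Q./ (suc k !)) {{suc k ℕP.!≢0}})

  bernoulliCoeff : ℕ → Carrier
  bernoulliCoeff j = fromℚ (bernoulliOverFact j)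

  expCoeff-0 : expCoeff 0 ≈ 1#
  expCoeff-0 = fromℚ-1

  bernoulliCoeff-0 : bernoulliCoeff 0 ≈ 1#
  bernoulliCoeff-0 = trans (fromℚ-homo-* Q.1ℚ Q.1ℚ) (trans (*-cong fromℚ-1 fromℚ-1) (*-identityˡ _))

  δ₀ : ℕ → Carrier
  δ₀ zero    = 1#
  δ₀ (suc _) = 0#

  Σ<-distribˡ : ∀ n a f → a * Σ< n f ≈ Σ< n (λ i → a * f i)
  Σ<-distribˡ zero    a f = zeroʳ a
  Σ<-distribˡ (suc n) a f = trans (distribˡ _ _ _) (+-congʳ (Σ<-distribˡ n a f))

  fromℚ-sum : ∀ {A : Set} (h : A → ℚ) (l : List A) →
              fromℚ (foldr Q._+_ Q.0ℚ (map h l)) ≈ sumL (map (λ a → fromℚ (h a)) l)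
  fromℚ-sum h []      = fromℚ-0
  fromℚ-sum h (x ∷ l) = trans (fromℚ-homo-+ (h x) _) (+-congˡ (fromℚ-sum h l))

  private
    B : ℕ → Carrier
    B j = fromℚ (bernoulli j)

    binomial : ℕ → ℕ → Carrier
    binomial n j = fromℕ (n C j)

  bernoulli-recurrence : ∀ n → fromℕ (2 +ℕ n) * B (suc n) + Σ< (suc n) (λ j → binomial (2 +ℕ n) j * B j) ≈ 0#
  bernoulli-recurrence n = begin
    N * B (suc n) + X                      ≈⟨ +-congʳ (*-congˡ B[n+1]≈) ⟩
    N * - (1/N * X) + X
      ≈⟨ solve 3 (λ d i x → d :* (:- (i :* x)) :+ x := x :+ :- (x :* (i :* d))) refl N 1/N X ⟩
    X + - (X * (1/N * N))                  ≈⟨ +-congˡ (-‿cong (*-congˡ (fromℚ-1/n*n (2 +ℕ n)))) ⟩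
    X + - (X * 1#)                         ≈⟨ +-congˡ (-‿cong (*-identityʳ X)) ⟩
    X + - X                                ≈⟨ -‿inverseʳ X ⟩
    0#                                     ∎
    where
    N : Carrier
    N = fromℕ (2 +ℕ n)
    q : ℚ
    q = + 1 Q./ (2 +ℕ n)
    1/N : Carrier
    1/N = fromℚ q
    X : Carrier
    X = Σ< (suc n) (λ j → binomial (2 +ℕ n) j * B j)
    term : ℕ × ℚ → ℚ
    term (j , b) = ℕtoℚ ((2 +ℕ n) C j) Q.* b
    sumℚ : ℚ
    sumℚ = foldr Q._+_ Q.0ℚ (map term (zip (upTo (suc n)) (bernoulliList (suc n))))
    sumℚ≈X : fromℚ sumℚ ≈ X
    sumℚ≈X = begin
      fromℚ sumℚ
        ≡⟨ P.cong (λ l → fromℚ (foldr Q._+_ Q.0ℚ (map term (zip (upTo (suc n)) l)))) (bernoulliList≡map (suc n)) ⟩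
      fromℚ (foldr Q._+_ Q.0ℚ (map term (zip (upTo (suc n)) (map bernoulli (upTo (suc n))))))
        ≡⟨ P.cong (λ l → fromℚ (foldr Q._+_ Q.0ℚ (map term l))) (zip-map bernoulli (upTo (suc n))) ⟩
      fromℚ (foldr Q._+_ Q.0ℚ (map term (map (λ j → j , bernoulli j) (upTo (suc n)))))
        ≡⟨ P.cong (λ l → fromℚ (foldr Q._+_ Q.0ℚ l))
                  (P.sym (LP.map-∘ {g = term} {f = λ j → j , bernoulli j} (upTo (suc n)))) ⟩
      fromℚ (foldr Q._+_ Q.0ℚ (map (λ j → term (j , bernoulli j)) (upTo (suc n))))
        ≈⟨ fromℚ-sum (λ j → term (j , bernoulli j)) (upTo (suc n)) ⟩
      sumL (map (λ j → fromℚ (term (j , bernoulli j))) (upTo (suc n)))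
        ≈⟨ sumL-upTo (suc n) _ ⟩
      Σ< (suc n) (λ j → fromℚ (ℕtoℚ ((2 +ℕ n) C j) Q.* bernoulli j))
        ≈⟨ Σ<-cong′ (suc n) (λ j → trans (fromℚ-homo-* (ℕtoℚ ((2 +ℕ n) C j)) (bernoulli j))
                                         (*-congʳ (fromℚ-ℕ ((2 +ℕ n) C j)))) ⟩
      X ∎
    B[n+1]≈ : B (suc n) ≈ - (1/N * X)
    B[n+1]≈ = trans (fromℚ-homo‿- (q Q.* sumℚ)) (-‿cong (trans (fromℚ-homo-* q sumℚ) (*-congˡ sumℚ≈X)))

  factorial-scaled-term : ∀ n k → k < 2 +ℕ n →
    fromℕ ((2 +ℕ n) !) * (expCoeff k * bernoulliCoeff (suc n ∸ k)) ≈ binomial (2 +ℕ n) (suc n ∸ k) * B (suc n ∸ k)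
  factorial-scaled-term n k k<n+2 = begin
    fromℕ ((2 +ℕ n) !) * (expCoeff k * bernoulliCoeff j)
      ≈⟨ *-cong (sym factorials) (*-congˡ (fromℚ-homo-* (bernoulli j) _)) ⟩
    (Cj * (fromℕ (j !) * fromℕ (suc k !))) * (expCoeff k * (B j * 1/j!))
      ≈⟨ solve 6 (λ z J K x b y → (z :* (J :* K)) :* (x :* (b :* y)) := (z :* b) :* (x :* K) :* (y :* J))
               refl Cj (fromℕ (j !)) (fromℕ (suc k !)) (expCoeff k) (B j) 1/j! ⟩
    (Cj * B j) * (expCoeff k * fromℕ (suc k !)) * (1/j! * fromℕ (j !))
      ≈⟨ *-cong (*-congˡ (fromℚ-1/n*n (suc k !) {{suc k ℕP.!≢0}})) (fromℚ-1/n*n (j !) {{j ℕP.!≢0}}) ⟩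
    (Cj * B j) * 1# * 1#
      ≈⟨ trans (*-identityʳ _) (*-identityʳ _) ⟩
    Cj * B j
      ∎
    where
    j : ℕ
    j = suc n ∸ k
    Cj : Carrier
    Cj = binomial (2 +ℕ n) j
    1/j! : Carrier
    1/j! = fromℚ ((+ 1 Q./ (j !)) {{j ℕP.!≢0}})
    n+2∸j≡k+1 : 2 +ℕ n ∸ j ≡ suc k
    n+2∸j≡k+1 = P.trans (ℕP.+-∸-assoc 1 (ℕP.m∸n≤m (suc n) k)) (P.cong suc (ℕP.m∸[m∸n]≡n (ℕP.≤-pred k<n+2)))
    factorials : Cj * (fromℕ (j !) * fromℕ (suc k !)) ≈ fromℕ ((2 +ℕ n) !)
    factorials = begin
      Cj * (fromℕ (j !) * fromℕ (suc k !))   ≈⟨ *-congˡ (sym (fromℕ-homo-* (j !) (suc k !))) ⟩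
      Cj * fromℕ (j ! *ℕ suc k !)            ≈⟨ sym (fromℕ-homo-* ((2 +ℕ n) C j) _) ⟩
      fromℕ (((2 +ℕ n) C j) *ℕ (j ! *ℕ suc k !))
        ≡⟨ P.cong (λ t → fromℕ (((2 +ℕ n) C j) *ℕ (j ! *ℕ t !))) (P.sym n+2∸j≡k+1) ⟩
      fromℕ (((2 +ℕ n) C j) *ℕ (j ! *ℕ (2 +ℕ n ∸ j) !))
        ≡⟨ P.cong fromℕ (nCk*[k!*[n∸k]!]≡n! (ℕP.m∸n≤m (2 +ℕ n) (suc k))) ⟩
      fromℕ ((2 +ℕ n) !)                     ∎

  -- The coefficientwise form of ((eᵗ - 1)/t) · (t/(eᵗ - 1)) = 1.
  expCoeff-bernoulliCoeff-convolution : ∀ m → Σ< (suc m) (λ k → expCoeff k * bernoulliCoeff (m ∸ k)) ≈ δ₀ m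
  expCoeff-bernoulliCoeff-convolution zero = begin
    0# + expCoeff 0 * bernoulliCoeff 0   ≈⟨ +-identityˡ _ ⟩
    expCoeff 0 * bernoulliCoeff 0        ≈⟨ *-cong expCoeff-0 bernoulliCoeff-0 ⟩
    1# * 1#                              ≈⟨ *-identityˡ _ ⟩
    1#                                   ∎
  expCoeff-bernoulliCoeff-convolution (suc n) =
    *-cancelʳ-≈0 (fromℕ-≉0 ((2 +ℕ n) !) {{(2 +ℕ n) ℕP.!≢0}}) (trans (*-comm _ _) (begin
      fromℕ ((2 +ℕ n) !) * Σ< (2 +ℕ n) (λ k → expCoeff k * bernoulliCoeff (suc n ∸ k))
        ≈⟨ Σ<-distribˡ (2 +ℕ n) _ _ ⟩
      Σ< (2 +ℕ n) (λ k → fromℕ ((2 +ℕ n) !) * (expCoeff k * bernoulliCoeff (suc n ∸ k)))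
        ≈⟨ Σ<-cong (2 +ℕ n) (factorial-scaled-term n) ⟩
      Σ< (2 +ℕ n) (λ k → h (2 +ℕ n ∸ suc k))   ≈⟨ Σ<-reverse (2 +ℕ n) h ⟩
      Σ< (suc n) h + binomial (2 +ℕ n) (suc n) * B (suc n)
        ≡⟨ P.cong (λ t → Σ< (suc n) h + fromℕ t * B (suc n)) n+2C[n+1]≡n+2 ⟩
      Σ< (suc n) h + fromℕ (2 +ℕ n) * B (suc n)   ≈⟨ +-comm _ _ ⟩
      fromℕ (2 +ℕ n) * B (suc n) + Σ< (suc n) h   ≈⟨ bernoulli-recurrence n ⟩
      0#                                          ∎))
    where
    h : ℕ → Carrier
    h j = binomial (2 +ℕ n) j * B j
    n+2C[n+1]≡n+2 : (2 +ℕ n) C suc n ≡ 2 +ℕ n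
    n+2C[n+1]≡n+2 = P.trans (nCk≡nC[n∸k] (ℕP.n≤1+n (suc n)))
                    (P.trans (P.cong ((2 +ℕ n) C_) (ℕP.m+n∸n≡m 1 (suc n))) (nC1≡n (2 +ℕ n)))

upTo-< : ∀ n → All (_< n) (upTo n)
upTo-< n = AllP.applyUpTo⁺₁ (λ i → i) n (λ i<n → i<n)

concatMap-cong-local : ∀ {A B : Set} {f g : A → List B} {xs : List A} →
                       All (λ x → f x ≡ g x) xs → concatMap f xs ≡ concatMap g xs
concatMap-cong-local f≡g = P.cong concat (LP.map-cong-local f≡g)

All-concatMap : ∀ {A B : Set} {f : A → List B} {R : B → Set} {xs : List A} →
                All (λ x → All R (f x)) xs → All R (concatMap f xs)
All-concatMap Rf = AllP.concat⁺ (AllP.map⁺ Rf)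

treesWith-fuel : ∀ f g k → k ≤ f → k ≤ g → treesWith f k ≡ treesWith g k
treesWith-fuel f       g       zero          _         _         = P.refl
treesWith-fuel f       g       (suc zero)    _         _         = P.refl
treesWith-fuel (suc f) (suc g) (suc (suc n)) (s≤s k≤f) (s≤s k≤g) =
  concatMap-cong-local (All.map (λ {i} i<n+1 →
    P.cong₂ (λ as bs → concatMap (λ a → map (a ∨_) bs) as)
      (treesWith-fuel f g (suc i) (ℕP.≤-trans i<n+1 k≤f) (ℕP.≤-trans i<n+1 k≤g))
      (treesWith-fuel f g (suc (n ∸ i)) (ℕP.≤-trans (s≤s (ℕP.m∸n≤m n i)) k≤f)
                                         (ℕP.≤-trans (s≤s (ℕP.m∸n≤m n i)) k≤g)))
    (upTo-< (suc n)))

treesWith-leaves : ∀ f k → All (λ T → leaves T ≡ k) (treesWith f k)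
treesWith-leaves f       zero          = []
treesWith-leaves f       (suc zero)    = P.refl ∷ []
treesWith-leaves zero    (suc (suc n)) = []
treesWith-leaves (suc f) (suc (suc n)) =
  All-concatMap (All.map (λ {i} i<n+1 →
    All-concatMap (All.map (λ {a} a-leaves →
      AllP.map⁺ (All.map (λ {b} b-leaves → P.trans (P.cong₂ _+ℕ_ a-leaves b-leaves) (sizes-add-up (ℕP.≤-pred i<n+1)))
                         (treesWith-leaves f (suc (n ∸ i)))))
      (treesWith-leaves f (suc i))))
    (upTo-< (suc n)))
  where
  sizes-add-up : ∀ {i} → i ≤ n → suc i +ℕ suc (n ∸ i) ≡ 2 +ℕ n
  sizes-add-up {i} i≤n = P.cong suc (P.trans (ℕP.+-suc i (n ∸ i)) (P.cong suc (ℕP.m+[n∸m]≡n i≤n)))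

rightLength<leaves : ∀ T → rightLength T < leaves T
rightLength<leaves ∣       = s≤s z≤n
rightLength<leaves (a ∨ b) =
  ℕP.≤-trans (ℕP.+-monoˡ-≤ (suc (rightLength b)) (1≤leaves a)) (ℕP.+-monoʳ-≤ (leaves a) (rightLength<leaves b))
  where
  1≤leaves : ∀ T → 1 ≤ leaves T
  1≤leaves ∣       = s≤s z≤n
  1≤leaves (a ∨ b) = ℕP.≤-trans (1≤leaves a) (ℕP.m≤m+n (leaves a) (leaves b))

module FilteredModule {c ℓ m ℓm ℓf} (F : Field c ℓ)
         (M : Module (Field.commutativeRing F) m ℓm) (L : CompletePreLie F M ℓf) where
  open Field F
  open Module M
  open CompletePreLie L
  open FiniteSums +ᴹ-commutativeMonoid public using ()
    renaming (Σ< to Σᴹ; Σ<-cong to Σᴹ-cong; Σ<-cong′ to Σᴹ-cong′; Σ<-distrib to Σᴹ-distrib; Σ<-ε to Σᴹ-0;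
              Σ<-cons to Σᴹ-cons; interchange to +ᴹ-interchange;
              sumL to sumᴹ; sumL-++ to sumᴹ-++; sumL-upTo to sumᴹ-upTo)
  module ≈ᴹ-Reasoning = Relation.Binary.Reasoning.Setoid ≈ᴹ-setoid
  open GroupProperties +ᴹ-group using (ε⁻¹≈ε; inverseʳ-unique)
  open AbelianGroupProperties +ᴹ-abelianGroup using (⁻¹-∙-comm; ⁻¹-anti-homo‿-)

  infixl 6 _-ᴹ_
  _-ᴹ_ : Carrierᴹ → Carrierᴹ → Carrierᴹ
  a -ᴹ b = a +ᴹ -ᴹ b

  -ᴹ-homo-+ : ∀ a b a′ b′ → (a +ᴹ b) -ᴹ (a′ +ᴹ b′) ≈ᴹ (a -ᴹ a′) +ᴹ (b -ᴹ b′)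
  -ᴹ-homo-+ a b a′ b′ = ≈ᴹ-trans (+ᴹ-congˡ (≈ᴹ-sym (⁻¹-∙-comm a′ b′))) (+ᴹ-interchange _ _ _ _)

  -ᴹ-telescope : ∀ u v w → (u -ᴹ v) +ᴹ (v -ᴹ w) ≈ᴹ u -ᴹ w
  -ᴹ-telescope u v w = begin
    (u -ᴹ v) +ᴹ (v -ᴹ w)       ≈⟨ +ᴹ-assoc _ _ _ ⟩
    u +ᴹ (-ᴹ v +ᴹ (v -ᴹ w))    ≈⟨ +ᴹ-congˡ (≈ᴹ-sym (+ᴹ-assoc _ _ _)) ⟩
    u +ᴹ ((-ᴹ v +ᴹ v) -ᴹ w)    ≈⟨ +ᴹ-congˡ (+ᴹ-congʳ (-ᴹ‿inverseˡ v)) ⟩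
    u +ᴹ (0ᴹ -ᴹ w)             ≈⟨ +ᴹ-congˡ (+ᴹ-identityˡ _) ⟩
    u -ᴹ w                     ∎
    where open ≈ᴹ-Reasoning

  -1*ₗ : ∀ v → (- 1#) *ₗ v ≈ᴹ -ᴹ v
  -1*ₗ v = inverseʳ-unique v ((- 1#) *ₗ v) (begin
    v +ᴹ (- 1#) *ₗ v         ≈⟨ +ᴹ-congʳ (≈ᴹ-sym (*ₗ-identityˡ v)) ⟩
    1# *ₗ v +ᴹ (- 1#) *ₗ v   ≈⟨ ≈ᴹ-sym (*ₗ-distribʳ v 1# (- 1#)) ⟩
    (1# + - 1#) *ₗ v         ≈⟨ *ₗ-congʳ (-‿inverseʳ 1#) ⟩
    0# *ₗ v                  ≈⟨ *ₗ-zeroˡ v ⟩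
    0ᴹ                       ∎)
    where open ≈ᴹ-Reasoning

  *ₗ-distribˡ-ᴹ : ∀ r a b → r *ₗ (a -ᴹ b) ≈ᴹ r *ₗ a -ᴹ r *ₗ b
  *ₗ-distribˡ-ᴹ r a b = begin
    r *ₗ (a -ᴹ b)                ≈⟨ *ₗ-distribˡ r a (-ᴹ b) ⟩
    r *ₗ a +ᴹ r *ₗ (-ᴹ b)        ≈⟨ +ᴹ-congˡ (*ₗ-congˡ (≈ᴹ-sym (-1*ₗ b))) ⟩
    r *ₗ a +ᴹ r *ₗ ((- 1#) *ₗ b) ≈⟨ +ᴹ-congˡ (≈ᴹ-sym (*ₗ-assoc r (- 1#) b)) ⟩
    r *ₗ a +ᴹ (r * - 1#) *ₗ b    ≈⟨ +ᴹ-congˡ (*ₗ-congʳ (*-comm r (- 1#))) ⟩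
    r *ₗ a +ᴹ (- 1# * r) *ₗ b    ≈⟨ +ᴹ-congˡ (*ₗ-assoc (- 1#) r b) ⟩
    r *ₗ a +ᴹ (- 1#) *ₗ (r *ₗ b) ≈⟨ +ᴹ-congˡ (-1*ₗ _) ⟩
    r *ₗ a -ᴹ r *ₗ b             ∎
    where open ≈ᴹ-Reasoning

  ▷-zeroˡ : ∀ a → 0ᴹ ▷ a ≈ᴹ 0ᴹ
  ▷-zeroˡ a = begin
    0ᴹ ▷ a          ≈⟨ ▷-cong (≈ᴹ-sym (*ₗ-zeroˡ 0ᴹ)) ≈ᴹ-refl ⟩
    (0# *ₗ 0ᴹ) ▷ a  ≈⟨ ▷-scalarˡ 0# 0ᴹ a ⟩
    0# *ₗ (0ᴹ ▷ a)  ≈⟨ *ₗ-zeroˡ _ ⟩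
    0ᴹ              ∎
    where open ≈ᴹ-Reasoning

  ▷-zeroʳ : ∀ a → a ▷ 0ᴹ ≈ᴹ 0ᴹ
  ▷-zeroʳ a = begin
    a ▷ 0ᴹ          ≈⟨ ▷-cong ≈ᴹ-refl (≈ᴹ-sym (*ₗ-zeroˡ 0ᴹ)) ⟩
    a ▷ (0# *ₗ 0ᴹ)  ≈⟨ ▷-scalarʳ 0# a 0ᴹ ⟩
    0# *ₗ (a ▷ 0ᴹ)  ≈⟨ *ₗ-zeroˡ _ ⟩
    0ᴹ              ∎
    where open ≈ᴹ-Reasoning

  ▷-distribʳ-ᴹ : ∀ a a′ b → (a -ᴹ a′) ▷ b ≈ᴹ a ▷ b -ᴹ a′ ▷ b
  ▷-distribʳ-ᴹ a a′ b = begin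
    (a -ᴹ a′) ▷ b                ≈⟨ ▷-distribʳ b a (-ᴹ a′) ⟩
    a ▷ b +ᴹ (-ᴹ a′) ▷ b         ≈⟨ +ᴹ-congˡ (▷-cong (≈ᴹ-sym (-1*ₗ a′)) ≈ᴹ-refl) ⟩
    a ▷ b +ᴹ ((- 1#) *ₗ a′) ▷ b  ≈⟨ +ᴹ-congˡ (▷-scalarˡ (- 1#) a′ b) ⟩
    a ▷ b +ᴹ (- 1#) *ₗ (a′ ▷ b)  ≈⟨ +ᴹ-congˡ (-1*ₗ _) ⟩
    a ▷ b -ᴹ a′ ▷ b              ∎
    where open ≈ᴹ-Reasoning

  ▷-distribˡ-ᴹ : ∀ a b b′ → a ▷ (b -ᴹ b′) ≈ᴹ a ▷ b -ᴹ a ▷ b′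
  ▷-distribˡ-ᴹ a b b′ = begin
    a ▷ (b -ᴹ b′)                ≈⟨ ▷-distribˡ a b (-ᴹ b′) ⟩
    a ▷ b +ᴹ a ▷ (-ᴹ b′)         ≈⟨ +ᴹ-congˡ (▷-cong ≈ᴹ-refl (≈ᴹ-sym (-1*ₗ b′))) ⟩
    a ▷ b +ᴹ a ▷ ((- 1#) *ₗ b′)  ≈⟨ +ᴹ-congˡ (▷-scalarʳ (- 1#) a b′) ⟩
    a ▷ b +ᴹ (- 1#) *ₗ (a ▷ b′)  ≈⟨ +ᴹ-congˡ (-1*ₗ _) ⟩
    a ▷ b -ᴹ a ▷ b′              ∎
    where open ≈ᴹ-Reasoning

  Fil-0th : ∀ v → Fil 0 v
  Fil-0th v = Fil-dec (Fil-1 v)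

  Fil-≤ : ∀ {p q v} → p ≤ q → Fil q v → Fil p v
  Fil-≤ p≤q = go (ℕP.≤⇒≤′ p≤q)
    where
    go : ∀ {p q v} → p ℕ.≤′ q → Fil q v → Fil p v
    go ℕ.≤′-refl       v∈Fq = v∈Fq
    go (ℕ.≤′-step p≤q) v∈Fq = go p≤q (Fil-dec v∈Fq)

  Fil-≡ : ∀ {p q v} → p ≡ q → Fil q v → Fil p v
  Fil-≡ p≡q = P.subst (λ r → Fil r _) (P.sym p≡q)

  Fil-‿- : ∀ {p v} → Fil p v → Fil p (-ᴹ v)
  Fil-‿- v∈Fp = Fil-resp (-1*ₗ _) (Fil-*ₗ (- 1#) v∈Fp)

  Graded : (ℕ → Carrierᴹ) → Set ℓf
  Graded A = ∀ n → Fil n (A n)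

  infix 4 _≈[_]_
  _≈[_]_ : Carrierᴹ → ℕ → Carrierᴹ → Set ℓf
  a ≈[ p ] b = Fil p (a -ᴹ b)

  ≈[]-refl : ∀ {p a} → a ≈[ p ] a
  ≈[]-refl {p} {a} = Fil-resp (≈ᴹ-sym (-ᴹ‿inverseʳ a)) (Fil-0 p)

  ≈[]-sym : ∀ {p a b} → a ≈[ p ] b → b ≈[ p ] a
  ≈[]-sym {p} {a} {b} a≈b = Fil-resp (⁻¹-anti-homo‿- a b) (Fil-‿- a≈b)

  ≈[]-trans : ∀ {p a b d} → a ≈[ p ] b → b ≈[ p ] d → a ≈[ p ] d
  ≈[]-trans a≈b b≈d = Fil-resp (-ᴹ-telescope _ _ _) (Fil-+ a≈b b≈d)

  ≈[]-setoid : ℕ → Setoid m ℓf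
  ≈[]-setoid p = record
    { Carrier       = Carrierᴹ
    ; _≈_           = _≈[ p ]_
    ; isEquivalence = record { refl = ≈[]-refl ; sym = ≈[]-sym ; trans = ≈[]-trans } }

  module ≈[]-Reasoning (p : ℕ) = Relation.Binary.Reasoning.Setoid (≈[]-setoid p)

  ≈ᴹ⇒≈[] : ∀ {p a b} → a ≈ᴹ b → a ≈[ p ] b
  ≈ᴹ⇒≈[] {p} {a} {b} a≈b = Fil-resp (+ᴹ-congʳ (≈ᴹ-sym a≈b)) (≈[]-refl {p} {b})

  Fil⇒≈[]0 : ∀ {p a} → Fil p a → a ≈[ p ] 0ᴹ
  Fil⇒≈[]0 a∈Fp = Fil-resp (≈ᴹ-sym (≈ᴹ-trans (+ᴹ-congˡ ε⁻¹≈ε) (+ᴹ-identityʳ _))) a∈Fp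

  ≈[]-+ : ∀ {p a a′ b b′} → a ≈[ p ] a′ → b ≈[ p ] b′ → a +ᴹ b ≈[ p ] a′ +ᴹ b′
  ≈[]-+ a≈a′ b≈b′ = Fil-resp (≈ᴹ-sym (-ᴹ-homo-+ _ _ _ _)) (Fil-+ a≈a′ b≈b′)

  ≈[]-+-cancelʳ : ∀ {p a a′ b b′} → a +ᴹ b ≈[ p ] a′ +ᴹ b′ → b ≈[ p ] b′ → a ≈[ p ] a′
  ≈[]-+-cancelʳ {p} {a} {a′} {b} {b′} sums b≈b′ =
    Fil-resp cancel (Fil-+ (Fil-resp (-ᴹ-homo-+ a b a′ b′) sums) (Fil-‿- b≈b′))
    where
    cancel : ((a -ᴹ a′) +ᴹ (b -ᴹ b′)) -ᴹ (b -ᴹ b′) ≈ᴹ a -ᴹ a′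
    cancel = ≈ᴹ-trans (+ᴹ-assoc _ _ _) (≈ᴹ-trans (+ᴹ-congˡ (-ᴹ‿inverseʳ _)) (+ᴹ-identityʳ _))

  ≈[]-*ₗ : ∀ {p a a′} r → a ≈[ p ] a′ → r *ₗ a ≈[ p ] r *ₗ a′
  ≈[]-*ₗ r a≈a′ = Fil-resp (*ₗ-distribˡ-ᴹ r _ _) (Fil-*ₗ r a≈a′)

  ≈[]-▷ : ∀ {p a a′ b b′} → a ≈[ p ] a′ → b ≈[ p ] b′ → a ▷ b ≈[ suc p ] a′ ▷ b′
  ≈[]-▷ {p} {a} {a′} {b} {b′} a≈a′ b≈b′ =
    Fil-resp split (Fil-+ (Fil-≡ (ℕP.+-comm 1 p) (Fil-▷ a≈a′ (Fil-1 b))) (Fil-▷ (Fil-1 a′) b≈b′))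
    where
    split : (a -ᴹ a′) ▷ b +ᴹ a′ ▷ (b -ᴹ b′) ≈ᴹ a ▷ b -ᴹ a′ ▷ b′
    split = ≈ᴹ-trans (+ᴹ-cong (▷-distribʳ-ᴹ a a′ b) (▷-distribˡ-ᴹ a′ b b′)) (-ᴹ-telescope _ _ _)

  ≈[]-▷ʳ : ∀ {p q a b b′} → Fil q a → b ≈[ p ] b′ → a ▷ b ≈[ q +ℕ p ] a ▷ b′
  ≈[]-▷ʳ a∈Fq b≈b′ = Fil-resp (▷-distribˡ-ᴹ _ _ _) (Fil-▷ a∈Fq b≈b′)

  Σᴹ-≈[] : ∀ n {p f g} → (∀ i → i < n → f i ≈[ p ] g i) → Σᴹ n f ≈[ p ] Σᴹ n g
  Σᴹ-≈[] zero    _   = ≈[]-refl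
  Σᴹ-≈[] (suc n) f≈g = ≈[]-+ (Σᴹ-≈[] n (λ i i<n → f≈g i (ℕP.m<n⇒m<1+n i<n))) (f≈g n ℕP.≤-refl)

  Σᴹ-▷ˡ : ∀ n f v → Σᴹ n f ▷ v ≈ᴹ Σᴹ n (λ i → f i ▷ v)
  Σᴹ-▷ˡ zero    f v = ▷-zeroˡ v
  Σᴹ-▷ˡ (suc n) f v = ≈ᴹ-trans (▷-distribʳ v _ _) (+ᴹ-congʳ (Σᴹ-▷ˡ n f v))

  Σᴹ-*ₗ : ∀ n r f → r *ₗ Σᴹ n f ≈ᴹ Σᴹ n (λ i → r *ₗ f i)
  Σᴹ-*ₗ zero    r f = *ₗ-zeroʳ r
  Σᴹ-*ₗ (suc n) r f = ≈ᴹ-trans (*ₗ-distribˡ r _ _) (+ᴹ-congʳ (Σᴹ-*ₗ n r f))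

  Stable : (ℕ → Carrierᴹ) → Set ℓf
  Stable s = ∀ {p n} → p ≤ n → s n ≈[ p ] s p

  Σᴹ-stable : ∀ {f} → (∀ k → Fil (suc k) (f k)) → Stable (λ n → Σᴹ n f)
  Σᴹ-stable {f} f∈F p≤n = go (ℕP.≤⇒≤′ p≤n)
    where
    go : ∀ {p n} → p ℕ.≤′ n → Σᴹ n f ≈[ p ] Σᴹ p f
    go ℕ.≤′-refl = ≈[]-refl
    go {p} (ℕ.≤′-step {n} p≤n) = ≈[]-trans last-term-small (go p≤n)
      where
      last-term-small : Σᴹ n f +ᴹ f n ≈[ p ] Σᴹ n f
      last-term-small = ≈[]-trans (≈[]-+ ≈[]-refl (Fil⇒≈[]0 (Fil-≤ (ℕP.m≤n⇒m≤1+n (ℕP.≤′⇒≤ p≤n)) (f∈F n))))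
                                  (≈ᴹ⇒≈[] (+ᴹ-identityʳ _))

  _⟶_ : (ℕ → Carrierᴹ) → Carrierᴹ → Set ℓf
  s ⟶ l = ∀ p → ∃ λ N → ∀ n → N ≤ n → s n ≈[ p ] l

  stable⇒cauchy : ∀ {s} → Stable s → ∀ p → ∃ λ N → ∀ n k → N ≤ n → N ≤ k → s n ≈[ p ] s k
  stable⇒cauchy s-stable p = p , λ n k p≤n p≤k → ≈[]-trans (s-stable p≤n) (≈[]-sym (s-stable p≤k))

  stable-⟶ : ∀ {s l} → Stable s → (∀ p → s p ≈[ p ] l) → s ⟶ l
  stable-⟶ s-stable sₚ≈l p = p , λ n p≤n → ≈[]-trans (s-stable p≤n) (sₚ≈l p)

  ⟶-stable : ∀ {s l} → Stable s → s ⟶ l → ∀ p → s p ≈[ p ] l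
  ⟶-stable {s} s-stable s⟶l p = ≈[]-trans (≈[]-sym (s-stable (ℕP.m≤n⊔m N p))) (proj₂ (s⟶l p) (N ⊔ p) (ℕP.m≤m⊔n N p))
    where
    N : ℕ
    N = proj₁ (s⟶l p)

  partialSum : (ℕ → Carrierᴹ) → ℕ → Carrierᴹ
  partialSum A p = Σᴹ p (λ j → A (suc j))

  productPart : (ℕ → Carrierᴹ) → (ℕ → Carrierᴹ) → ℕ → Carrierᴹ
  productPart A B zero    = 0ᴹ
  productPart A B (suc p) = Σᴹ p (λ j → A (suc j) ▷ B (suc (p ∸ suc j)))

  partialSum-stable : ∀ {A} → Graded A → Stable (partialSum A)
  partialSum-stable A-graded = Σᴹ-stable (λ k → A-graded (suc k))

  partialSum-▷ : ∀ {A B} → Graded A → Graded B → ∀ p →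
                 partialSum A p ▷ partialSum B p ≈[ p ] partialSum (productPart A B) p
  partialSum-▷ {A} {B} A-graded B-graded p = begin
    partialSum A p ▷ partialSum B p                   ≈⟨ ≈ᴹ⇒≈[] (Σᴹ-▷ˡ p _ _) ⟩
    Σᴹ p (λ j → A (suc j) ▷ partialSum B p)           ≈⟨ Σᴹ-≈[] p truncate ⟩
    Σᴹ p (λ j → A (suc j) ▷ partialSum B (p ∸ suc j)) ≈⟨ ≈ᴹ⇒≈[] (regroup p) ⟩
    partialSum (productPart A B) p                    ∎
    where
    open ≈[]-Reasoning p
    truncate : ∀ j → j < p → A (suc j) ▷ partialSum B p ≈[ p ] A (suc j) ▷ partialSum B (p ∸ suc j)
    truncate j j<p = Fil-≡ (P.sym (ℕP.m+[n∸m]≡n j<p))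
                       (≈[]-▷ʳ (A-graded (suc j)) (partialSum-stable B-graded (ℕP.m∸n≤m p (suc j))))
    regroup : ∀ p → Σᴹ p (λ j → A (suc j) ▷ partialSum B (p ∸ suc j)) ≈ᴹ partialSum (productPart A B) p
    regroup zero    = ≈ᴹ-refl
    regroup (suc p) = ≈ᴹ-trans (≈ᴹ-trans split-last (Σᴹ-distrib p _ _)) (+ᴹ-congʳ (regroup p))
      where
      split-last : Σᴹ (suc p) (λ j → A (suc j) ▷ partialSum B (suc p ∸ suc j)) ≈ᴹ
                   Σᴹ p (λ j → A (suc j) ▷ partialSum B (p ∸ suc j) +ᴹ A (suc j) ▷ B (suc (p ∸ suc j)))
      split-last = ≈ᴹ-trans
        (+ᴹ-cong (Σᴹ-cong p (λ j j<p → ≈ᴹ-trans (≈ᴹ-reflexive (P.cong (λ t → A (suc j) ▷ partialSum B t) (ℕP.+-∸-assoc 1 j<p)))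
                                                 (▷-distribˡ _ _ _)))
                 (≈ᴹ-trans (≈ᴹ-reflexive (P.cong (λ t → A (suc p) ▷ partialSum B t) (ℕP.n∸n≡0 p))) (▷-zeroʳ _)))
        (+ᴹ-identityʳ _)

  module _ {A : Set} where
    sumᴹ-cong : ∀ (l : List A) {g h : A → Carrierᴹ} → (∀ a → g a ≈ᴹ h a) → sumᴹ (map g l) ≈ᴹ sumᴹ (map h l)
    sumᴹ-cong []      g≈h = ≈ᴹ-refl
    sumᴹ-cong (a ∷ l) g≈h = +ᴹ-cong (g≈h a) (sumᴹ-cong l g≈h)

    sumᴹ-cong-All : ∀ {Q : A → Set} {l : List A} {g h : A → Carrierᴹ} →
                    All Q l → (∀ {a} → Q a → g a ≈ᴹ h a) → sumᴹ (map g l) ≈ᴹ sumᴹ (map h l)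
    sumᴹ-cong-All []       g≈h = ≈ᴹ-refl
    sumᴹ-cong-All (q ∷ qs) g≈h = +ᴹ-cong (g≈h q) (sumᴹ-cong-All qs g≈h)

    sumᴹ-Fil-All : ∀ {Q : A → Set} {p} {l : List A} {g : A → Carrierᴹ} →
                   All Q l → (∀ {a} → Q a → Fil p (g a)) → Fil p (sumᴹ (map g l))
    sumᴹ-Fil-All {p = p} []       g∈F = Fil-0 p
    sumᴹ-Fil-All         (q ∷ qs) g∈F = Fil-+ (g∈F q) (sumᴹ-Fil-All qs g∈F)

    sumᴹ-distrib : ∀ (l : List A) g h → sumᴹ (map (λ a → g a +ᴹ h a) l) ≈ᴹ sumᴹ (map g l) +ᴹ sumᴹ (map h l)
    sumᴹ-distrib []      g h = ≈ᴹ-sym (+ᴹ-identityˡ 0ᴹ)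
    sumᴹ-distrib (a ∷ l) g h = ≈ᴹ-trans (+ᴹ-congˡ (sumᴹ-distrib l g h)) (+ᴹ-interchange _ _ _ _)

    sumᴹ-*ₗ : ∀ (l : List A) r g → r *ₗ sumᴹ (map g l) ≈ᴹ sumᴹ (map (λ a → r *ₗ g a) l)
    sumᴹ-*ₗ []      r g = *ₗ-zeroʳ r
    sumᴹ-*ₗ (a ∷ l) r g = ≈ᴹ-trans (*ₗ-distribˡ r _ _) (+ᴹ-congˡ (sumᴹ-*ₗ l r g))

    sumᴹ-▷ˡ : ∀ (l : List A) g v → sumᴹ (map g l) ▷ v ≈ᴹ sumᴹ (map (λ a → g a ▷ v) l)
    sumᴹ-▷ˡ []      g v = ▷-zeroˡ v
    sumᴹ-▷ˡ (a ∷ l) g v = ≈ᴹ-trans (▷-distribʳ v _ _) (+ᴹ-congˡ (sumᴹ-▷ˡ l g v))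

    sumᴹ-▷ʳ : ∀ (l : List A) g v → v ▷ sumᴹ (map g l) ≈ᴹ sumᴹ (map (λ a → v ▷ g a) l)
    sumᴹ-▷ʳ []      g v = ▷-zeroʳ v
    sumᴹ-▷ʳ (a ∷ l) g v = ≈ᴹ-trans (▷-distribˡ v _ _) (+ᴹ-congˡ (sumᴹ-▷ʳ l g v))

    sumᴹ-0 : ∀ (l : List A) → sumᴹ (map (λ _ → 0ᴹ) l) ≈ᴹ 0ᴹ
    sumᴹ-0 []      = ≈ᴹ-refl
    sumᴹ-0 (a ∷ l) = ≈ᴹ-trans (+ᴹ-identityˡ _) (sumᴹ-0 l)

  sumᴹ-concatMap : ∀ {A B : Set} (g : B → Carrierᴹ) (h : A → List B) (l : List A) →
                   sumᴹ (map g (concatMap h l)) ≈ᴹ sumᴹ (map (λ a → sumᴹ (map g (h a))) l)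
  sumᴹ-concatMap g h []      = ≈ᴹ-refl
  sumᴹ-concatMap g h (a ∷ l) = begin
    sumᴹ (map g (h a ++ concatMap h l))                  ≡⟨ P.cong sumᴹ (LP.map-++ g (h a) (concatMap h l)) ⟩
    sumᴹ (map g (h a) ++ map g (concatMap h l))          ≈⟨ sumᴹ-++ (map g (h a)) _ ⟩
    sumᴹ (map g (h a)) +ᴹ sumᴹ (map g (concatMap h l))   ≈⟨ +ᴹ-congˡ (sumᴹ-concatMap g h l) ⟩
    sumᴹ (map (λ a → sumᴹ (map g (h a))) (a ∷ l))        ∎
    where open ≈ᴹ-Reasoning

module ExponentialSeries {c ℓ m ℓm ℓf} (F : Field c ℓ) (ch0 : CharacteristicZero F)
         (M : Module (Field.commutativeRing F) m ℓm) (L : CompletePreLie F M ℓf) where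
  open Field F
  open Module M
  open CompletePreLie L
  open PreLieOps F ch0 M L using (rightPower; expPartial; IsLog)
  open BernoulliIdentity F ch0 using (expCoeff; expCoeff-0)
  open FilteredModule F M L

  expPartial≈Σᴹ : ∀ y n → expPartial y n ≈ᴹ Σᴹ (suc n) (λ k → expCoeff k *ₗ rightPower y k)
  expPartial≈Σᴹ y n = sumᴹ-upTo (suc n) (λ k → expCoeff k *ₗ rightPower y k)

  rightPower-Fil : ∀ y k → Fil (suc k) (rightPower y k)
  rightPower-Fil y zero    = Fil-1 y
  rightPower-Fil y (suc k) = Fil-▷ (Fil-1 y) (rightPower-Fil y k)

  rightPower-≈[] : ∀ {p y z} → y ≈[ p ] z → ∀ k → rightPower y k ≈[ p ] rightPower z k
  rightPower-≈[] y≈z zero    = y≈z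
  rightPower-≈[] y≈z (suc k) = Fil-dec (≈[]-▷ y≈z (rightPower-≈[] y≈z k))

  expPartial-stable : ∀ y → Stable (expPartial y)
  expPartial-stable y {p} {n} p≤n = begin
    expPartial y n                                          ≈⟨ ≈ᴹ⇒≈[] (expPartial≈Σᴹ y n) ⟩
    Σᴹ (suc n) (λ k → expCoeff k *ₗ rightPower y k)         ≈⟨ Fil-≤ (ℕP.n≤1+n p) (Σᴹ-stable terms∈F (s≤s p≤n)) ⟩
    Σᴹ (suc p) (λ k → expCoeff k *ₗ rightPower y k)         ≈⟨ ≈ᴹ⇒≈[] (≈ᴹ-sym (expPartial≈Σᴹ y p)) ⟩
    expPartial y p                                          ∎
    where
    open ≈[]-Reasoning p
    terms∈F : ∀ k → Fil (suc k) (expCoeff k *ₗ rightPower y k)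
    terms∈F k = Fil-*ₗ (expCoeff k) (rightPower-Fil y k)

  expPartial-≈[] : ∀ {p y z} → y ≈[ p ] z → ∀ n → expPartial y n ≈[ p ] expPartial z n
  expPartial-≈[] {p} {y} {z} y≈z n = begin
    expPartial y n                                   ≈⟨ ≈ᴹ⇒≈[] (expPartial≈Σᴹ y n) ⟩
    Σᴹ (suc n) (λ k → expCoeff k *ₗ rightPower y k)  ≈⟨ Σᴹ-≈[] (suc n) (λ k _ → ≈[]-*ₗ (expCoeff k) (rightPower-≈[] y≈z k)) ⟩
    Σᴹ (suc n) (λ k → expCoeff k *ₗ rightPower z k)  ≈⟨ ≈ᴹ⇒≈[] (≈ᴹ-sym (expPartial≈Σᴹ z n)) ⟩
    expPartial z n                                   ∎
    where open ≈[]-Reasoning p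

  isLog⇒expPartial≈[] : ∀ {x y} → IsLog x y → ∀ p → expPartial y p ≈[ p ] x
  isLog⇒expPartial≈[] {y = y} = ⟶-stable (expPartial-stable y)

  expPartial≈[]⇒isLog : ∀ {x y} → (∀ p → expPartial y p ≈[ p ] x) → IsLog x y
  expPartial≈[]⇒isLog {y = y} = stable-⟶ (expPartial-stable y)

  -- Modulo F^{q+1}, the exponential series of y is y plus terms determined by y modulo F^q.
  isLog-unique : ∀ {x y z} → IsLog x y → IsLog x z → ∀ q → y ≈[ q ] z
  isLog-unique         log-y log-z zero    = Fil-0th _
  isLog-unique {x} {y} {z} log-y log-z (suc q) =
    Fil-resp (+ᴹ-cong (unit y) (-ᴹ‿cong (unit z))) (≈[]-+-cancelʳ first+rest higher-terms)
    where
    y≈z : y ≈[ q ] z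
    y≈z = isLog-unique log-y log-z q
    higher : Carrierᴹ → Carrierᴹ
    higher v = Σᴹ (suc q) (λ k → expCoeff (suc k) *ₗ rightPower v (suc k))
    split : ∀ v → expPartial v (suc q) ≈ᴹ expCoeff 0 *ₗ v +ᴹ higher v
    split v = ≈ᴹ-trans (expPartial≈Σᴹ v (suc q)) (Σᴹ-cons (suc q) _)
    first+rest : expCoeff 0 *ₗ y +ᴹ higher y ≈[ suc q ] expCoeff 0 *ₗ z +ᴹ higher z
    first+rest = begin
      expCoeff 0 *ₗ y +ᴹ higher y  ≈⟨ ≈ᴹ⇒≈[] (≈ᴹ-sym (split y)) ⟩
      expPartial y (suc q)         ≈⟨ isLog⇒expPartial≈[] log-y (suc q) ⟩
      x                            ≈⟨ ≈[]-sym (isLog⇒expPartial≈[] log-z (suc q)) ⟩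
      expPartial z (suc q)         ≈⟨ ≈ᴹ⇒≈[] (split z) ⟩
      expCoeff 0 *ₗ z +ᴹ higher z  ∎
      where open ≈[]-Reasoning (suc q)
    higher-terms : higher y ≈[ suc q ] higher z
    higher-terms = Σᴹ-≈[] (suc q) (λ k _ → ≈[]-*ₗ (expCoeff (suc k)) (≈[]-▷ y≈z (rightPower-≈[] y≈z k)))
    unit : ∀ v → expCoeff 0 *ₗ v ≈ᴹ v
    unit v = ≈ᴹ-trans (*ₗ-congʳ expCoeff-0) (*ₗ-identityˡ v)

module TreeSeries {c ℓ m ℓm ℓf} (F : Field c ℓ) (ch0 : CharacteristicZero F)
         (M : Module (Field.commutativeRing F) m ℓm) (L : CompletePreLie F M ℓf)
         (x : Module.Carrierᴹ M) where
  open Field F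
  open Module M
  open CompletePreLie L
  open PreLieOps F ch0 M L using (rightPower; expPartial; IsLog; evalTree; treeSeriesPartial)
  open RationalEmbedding F ch0 using (fromℚ; fromℚ-1; fromℚ-homo-*)
  open BernoulliIdentity F ch0 using (expCoeff; bernoulliCoeff; bernoulliCoeff-0; δ₀; expCoeff-bernoulliCoeff-convolution)
  open FiniteSums +-commutativeMonoid using (Σ<; Σ<-cong; Σ<-split; Σ<-ε)
  open FilteredModule F M L
  open ExponentialSeries F ch0 M L
  module ≈ᴷ-Reasoning = Relation.Binary.Reasoning.Setoid setoid

  branchProduct : List ℕ → ℚ
  branchProduct ls = foldr Q._*_ Q.1ℚ (map bernoulliOverFact ls)

  fromℚ-branchProduct-++ : ∀ ks ls →
    fromℚ (branchProduct (ks ++ ls)) ≈ fromℚ (branchProduct ks) * fromℚ (branchProduct ls)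
  fromℚ-branchProduct-++ []       ls = sym (trans (*-congʳ fromℚ-1) (*-identityˡ _))
  fromℚ-branchProduct-++ (k ∷ ks) ls = begin
    fromℚ (bernoulliOverFact k Q.* branchProduct (ks ++ ls))
      ≈⟨ fromℚ-homo-* (bernoulliOverFact k) _ ⟩
    bernoulliCoeff k * fromℚ (branchProduct (ks ++ ls))
      ≈⟨ *-congˡ (fromℚ-branchProduct-++ ks ls) ⟩
    bernoulliCoeff k * (fromℚ (branchProduct ks) * fromℚ (branchProduct ls))
      ≈⟨ sym (*-assoc _ _ _) ⟩
    (bernoulliCoeff k * fromℚ (branchProduct ks)) * fromℚ (branchProduct ls)
      ≈⟨ *-congʳ (sym (fromℚ-homo-* (bernoulliOverFact k) (branchProduct ks))) ⟩
    fromℚ (branchProduct (k ∷ ks)) * fromℚ (branchProduct ls)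
      ∎
    where open ≈ᴷ-Reasoning

  treeTerm : Tree → Carrierᴹ
  treeTerm T = fromℚ (treeCoefficient T) *ₗ evalTree T x

  -- rightChildBranches T lists all right pointing branches of T except the one starting at the root.
  innerTerm : Tree → Carrierᴹ
  innerTerm T = fromℚ (branchProduct (rightChildBranches T)) *ₗ evalTree T x

  evalTree-Fil : ∀ T → Fil (leaves T) (evalTree T x)
  evalTree-Fil ∣       = Fil-1 x
  evalTree-Fil (a ∨ b) = Fil-▷ (evalTree-Fil a) (evalTree-Fil b)

  treeTerm≈innerTerm : ∀ T → treeTerm T ≈ᴹ bernoulliCoeff (rightLength T) *ₗ innerTerm T
  treeTerm≈innerTerm ∣ = ≈ᴹ-trans (*ₗ-congʳ fromℚ-1)
    (≈ᴹ-sym (≈ᴹ-trans (*ₗ-congʳ bernoulliCoeff-0) (≈ᴹ-trans (*ₗ-identityˡ _) (*ₗ-congʳ fromℚ-1))))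
  treeTerm≈innerTerm (a ∨ b) =
    ≈ᴹ-trans (*ₗ-congʳ (fromℚ-homo-* (bernoulliOverFact (suc (rightLength b))) _)) (*ₗ-assoc _ _ _)

  innerTerm-∨ : ∀ a b → innerTerm (a ∨ b) ≈ᴹ treeTerm a ▷ innerTerm b
  innerTerm-∨ a b = begin
    fromℚ (branchProduct (branchLengths a ++ rightChildBranches b)) *ₗ (evalTree a x ▷ evalTree b x)
      ≈⟨ *ₗ-congʳ (fromℚ-branchProduct-++ (branchLengths a) (rightChildBranches b)) ⟩
    (fromℚ (treeCoefficient a) * fromℚ (branchProduct (rightChildBranches b))) *ₗ (evalTree a x ▷ evalTree b x)
      ≈⟨ *ₗ-assoc _ _ _ ⟩
    fromℚ (treeCoefficient a) *ₗ (fromℚ (branchProduct (rightChildBranches b)) *ₗ (evalTree a x ▷ evalTree b x))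
      ≈⟨ *ₗ-congˡ (≈ᴹ-sym (▷-scalarʳ _ _ _)) ⟩
    fromℚ (treeCoefficient a) *ₗ (evalTree a x ▷ innerTerm b)
      ≈⟨ ≈ᴹ-sym (▷-scalarˡ _ _ _) ⟩
    treeTerm a ▷ innerTerm b
      ∎
    where open ≈ᴹ-Reasoning

  weightedPart : (ℕ → Carrier) → ℕ → Carrierᴹ
  weightedPart φ n = sumᴹ (map (λ T → φ (rightLength T) *ₗ innerTerm T) (treesOfSize n))

  weightedSum : (ℕ → Carrier) → ℕ → Carrierᴹ
  weightedSum φ = partialSum (weightedPart φ)

  treePart : ℕ → Carrierᴹ
  treePart n = sumᴹ (map treeTerm (treesOfSize n))

  treeSum : ℕ → Carrierᴹ
  treeSum = partialSum treePart

  weightedPart-graded : ∀ φ → Graded (weightedPart φ)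
  weightedPart-graded φ n = sumᴹ-Fil-All (treesWith-leaves n n)
    (λ {T} leaves≡n → Fil-≡ (P.sym leaves≡n) (Fil-*ₗ _ (Fil-*ₗ _ (evalTree-Fil T))))

  treePart-graded : Graded treePart
  treePart-graded n = sumᴹ-Fil-All (treesWith-leaves n n)
    (λ {T} leaves≡n → Fil-≡ (P.sym leaves≡n) (Fil-*ₗ _ (evalTree-Fil T)))

  treeSum≈weightedSum : ∀ p → treeSum p ≈ᴹ weightedSum bernoulliCoeff p
  treeSum≈weightedSum p = Σᴹ-cong′ p (λ j → sumᴹ-cong (treesOfSize (suc j)) treeTerm≈innerTerm)

  weightedSum-cong : ∀ p {φ ψ} → (∀ m → m < p → φ m ≈ ψ m) → weightedSum φ p ≈ᴹ weightedSum ψ p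
  weightedSum-cong p φ≈ψ = Σᴹ-cong p (λ j j<p → sumᴹ-cong-All (treesWith-leaves (suc j) (suc j))
    (λ {T} leaves≡j+1 → *ₗ-congʳ (φ≈ψ (rightLength T)
       (ℕP.≤-trans (P.subst (rightLength T <_) leaves≡j+1 (rightLength<leaves T)) j<p))))

  weightedSum-distrib : ∀ p φ ψ → weightedSum (λ m → φ m + ψ m) p ≈ᴹ weightedSum φ p +ᴹ weightedSum ψ p
  weightedSum-distrib p φ ψ = ≈ᴹ-trans
    (Σᴹ-cong′ p (λ j → ≈ᴹ-trans (sumᴹ-cong (treesOfSize (suc j)) (λ T → *ₗ-distribʳ _ _ _))
                                (sumᴹ-distrib (treesOfSize (suc j)) _ _)))
    (Σᴹ-distrib p _ _)

  weightedSum-* : ∀ p a φ → weightedSum (λ m → a * φ m) p ≈ᴹ a *ₗ weightedSum φ p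
  weightedSum-* p a φ = ≈ᴹ-trans
    (Σᴹ-cong′ p (λ j → ≈ᴹ-trans (sumᴹ-cong (treesOfSize (suc j)) (λ T → *ₗ-assoc _ _ _))
                                (≈ᴹ-sym (sumᴹ-*ₗ (treesOfSize (suc j)) a _))))
    (≈ᴹ-sym (Σᴹ-*ₗ p a _))

  weightedSum-0 : ∀ p → weightedSum (λ _ → 0#) p ≈ᴹ 0ᴹ
  weightedSum-0 p = Σᴹ-0 p (λ j _ → ≈ᴹ-trans (sumᴹ-cong (treesOfSize (suc j)) (λ T → *ₗ-zeroˡ _))
                                              (sumᴹ-0 (treesOfSize (suc j))))

  weightedSum-Σ< : ∀ p K (φ : ℕ → ℕ → Carrier) →
                   weightedSum (λ m → Σ< K (λ k → φ k m)) p ≈ᴹ Σᴹ K (λ k → weightedSum (φ k) p)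
  weightedSum-Σ< p zero    φ = weightedSum-0 p
  weightedSum-Σ< p (suc K) φ =
    ≈ᴹ-trans (weightedSum-distrib p (λ m → Σ< K (λ k → φ k m)) (φ K)) (+ᴹ-congʳ (weightedSum-Σ< p K φ))

  sumOver∨ : ℕ → ℕ → (Tree → Carrierᴹ) → Carrierᴹ
  sumOver∨ i j g = sumᴹ (map (λ a → sumᴹ (map (λ b → g (a ∨ b)) (treesOfSize j))) (treesOfSize i))

  treesOfSize-split : ∀ n g → sumᴹ (map g (treesOfSize (2 +ℕ n))) ≈ᴹ Σᴹ (suc n) (λ i → sumOver∨ (suc i) (suc (n ∸ i)) g)
  treesOfSize-split n g = begin
    sumᴹ (map g (concatMap pairs (upTo (suc n))))             ≈⟨ sumᴹ-concatMap g pairs (upTo (suc n)) ⟩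
    sumᴹ (map (λ i → sumᴹ (map g (pairs i))) (upTo (suc n)))  ≈⟨ sumᴹ-upTo (suc n) _ ⟩
    Σᴹ (suc n) (λ i → sumᴹ (map g (pairs i)))                 ≈⟨ Σᴹ-cong (suc n) pairs-sum ⟩
    Σᴹ (suc n) (λ i → sumOver∨ (suc i) (suc (n ∸ i)) g)       ∎
    where
    open ≈ᴹ-Reasoning
    pairs : ℕ → List Tree
    pairs i = concatMap (λ a → map (a ∨_) (treesWith (suc n) (suc (n ∸ i)))) (treesWith (suc n) (suc i))
    pairs-sum : ∀ i → i < suc n → sumᴹ (map g (pairs i)) ≈ᴹ sumOver∨ (suc i) (suc (n ∸ i)) g
    pairs-sum i i<n+1 = begin
      sumᴹ (map g (pairs i))
        ≈⟨ sumᴹ-concatMap g _ (treesWith (suc n) (suc i)) ⟩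
      sumᴹ (map (λ a → sumᴹ (map g (map (a ∨_) (treesWith (suc n) (suc (n ∸ i)))))) (treesWith (suc n) (suc i)))
        ≡⟨ P.cong₂ (λ as bs → sumᴹ (map (λ a → sumᴹ (map g (map (a ∨_) bs))) as))
             (treesWith-fuel (suc n) (suc i) (suc i) i<n+1 ℕP.≤-refl)
             (treesWith-fuel (suc n) (suc (n ∸ i)) (suc (n ∸ i)) (s≤s (ℕP.m∸n≤m n i)) ℕP.≤-refl) ⟩
      sumᴹ (map (λ a → sumᴹ (map g (map (a ∨_) (treesOfSize (suc (n ∸ i)))))) (treesOfSize (suc i)))
        ≈⟨ sumᴹ-cong (treesOfSize (suc i))
             (λ a → ≈ᴹ-reflexive (P.cong sumᴹ (P.sym (LP.map-∘ (treesOfSize (suc (n ∸ i))))))) ⟩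
      sumOver∨ (suc i) (suc (n ∸ i)) g
        ∎

  weightedPart-1 : ∀ φ → weightedPart φ 1 ≈ᴹ φ 0 *ₗ x
  weightedPart-1 φ = ≈ᴹ-trans (+ᴹ-identityʳ _) (*ₗ-congˡ (≈ᴹ-trans (*ₗ-congʳ fromℚ-1) (*ₗ-identityˡ x)))

  -- Splitting each tree at its root: the root branch of a ∨ b is that of b, lengthened by one edge.
  weightedPart-∨ : ∀ φ n → weightedPart φ (2 +ℕ n) ≈ᴹ productPart treePart (weightedPart (φ ∘ suc)) (2 +ℕ n)
  weightedPart-∨ φ n = ≈ᴹ-trans (treesOfSize-split n _) (Σᴹ-cong′ (suc n) λ i → begin
    sumOver∨ (suc i) (suc (n ∸ i)) (λ T → φ (rightLength T) *ₗ innerTerm T)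
      ≈⟨ sumᴹ-cong (left i) (λ a → sumᴹ-cong (right i)
           (λ b → ≈ᴹ-trans (*ₗ-congˡ (innerTerm-∨ a b)) (≈ᴹ-sym (▷-scalarʳ _ _ _)))) ⟩
    sumᴹ (map (λ a → sumᴹ (map (λ b → treeTerm a ▷ (φ (suc (rightLength b)) *ₗ innerTerm b)) (right i))) (left i))
      ≈⟨ sumᴹ-cong (left i) (λ a → ≈ᴹ-sym (sumᴹ-▷ʳ (right i) _ (treeTerm a))) ⟩
    sumᴹ (map (λ a → treeTerm a ▷ weightedPart (φ ∘ suc) (suc (n ∸ i))) (left i))
      ≈⟨ ≈ᴹ-sym (sumᴹ-▷ˡ (left i) treeTerm _) ⟩
    treePart (suc i) ▷ weightedPart (φ ∘ suc) (suc (n ∸ i))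
      ∎)
    where
    open ≈ᴹ-Reasoning
    left right : ℕ → List Tree
    left i = treesOfSize (suc i)
    right i = treesOfSize (suc (n ∸ i))

  weightedSum-suc : ∀ φ p →
    weightedSum φ (suc p) ≈ᴹ φ 0 *ₗ x +ᴹ partialSum (productPart treePart (weightedPart (φ ∘ suc))) (suc p)
  weightedSum-suc φ p = begin
    Σᴹ (suc p) (λ j → weightedPart φ (suc j))
      ≈⟨ Σᴹ-cons p _ ⟩
    weightedPart φ 1 +ᴹ Σᴹ p (λ j → weightedPart φ (2 +ℕ j))
      ≈⟨ +ᴹ-cong (weightedPart-1 φ) (Σᴹ-cong′ p (weightedPart-∨ φ)) ⟩
    φ 0 *ₗ x +ᴹ Σᴹ p (λ j → product (2 +ℕ j))
      ≈⟨ +ᴹ-congˡ (≈ᴹ-sym (+ᴹ-identityˡ _)) ⟩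
    φ 0 *ₗ x +ᴹ (product 1 +ᴹ Σᴹ p (λ j → product (2 +ℕ j)))
      ≈⟨ +ᴹ-congˡ (≈ᴹ-sym (Σᴹ-cons p _)) ⟩
    φ 0 *ₗ x +ᴹ partialSum product (suc p)
      ∎
    where
    open ≈ᴹ-Reasoning
    product : ℕ → Carrierᴹ
    product = productPart treePart (weightedPart (φ ∘ suc))

  weightedSum-recursion : ∀ φ p → weightedSum φ p ≈[ p ] φ 0 *ₗ x +ᴹ treeSum p ▷ weightedSum (φ ∘ suc) p
  weightedSum-recursion φ zero    = Fil-0th _
  weightedSum-recursion φ (suc p) = ≈[]-trans (≈ᴹ⇒≈[] (weightedSum-suc φ p))
    (≈[]-+ ≈[]-refl (≈[]-sym (partialSum-▷ treePart-graded (weightedPart-graded (φ ∘ suc)) (suc p))))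

  shiftBy : ℕ → (ℕ → Carrier) → ℕ → Carrier
  shiftBy zero    φ m       = φ m
  shiftBy (suc k) φ zero    = 0#
  shiftBy (suc k) φ (suc m) = shiftBy k φ m

  shiftBy-≥ : ∀ k m φ → k ≤ m → shiftBy k φ m ≡ φ (m ∸ k)
  shiftBy-≥ zero    m       φ _         = P.refl
  shiftBy-≥ (suc k) (suc m) φ (s≤s k≤m) = shiftBy-≥ k m φ k≤m

  shiftBy-< : ∀ k m φ → m < k → shiftBy k φ m ≡ 0#
  shiftBy-< (suc k) zero    φ _         = P.refl
  shiftBy-< (suc k) (suc m) φ (s≤s m<k) = shiftBy-< k m φ m<k

  -- weightedSum-recursion at a weight vanishing at 0: left multiplication by treeSum shifts the weight.
  rightPower-treeSum : ∀ p k → rightPower (treeSum p) k ≈[ p ] weightedSum (shiftBy k bernoulliCoeff) p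
  rightPower-treeSum p zero    = ≈ᴹ⇒≈[] (treeSum≈weightedSum p)
  rightPower-treeSum p (suc k) = begin
    treeSum p ▷ rightPower (treeSum p) k
      ≈⟨ Fil-dec (≈[]-▷ ≈[]-refl (rightPower-treeSum p k)) ⟩
    treeSum p ▷ weightedSum φ p
      ≈⟨ ≈ᴹ⇒≈[] (≈ᴹ-sym (≈ᴹ-trans (+ᴹ-congʳ (*ₗ-zeroˡ x)) (+ᴹ-identityˡ _))) ⟩
    shiftBy (suc k) bernoulliCoeff 0 *ₗ x +ᴹ treeSum p ▷ weightedSum φ p
      ≈⟨ ≈[]-sym (weightedSum-recursion (shiftBy (suc k) bernoulliCoeff) p) ⟩
    weightedSum (shiftBy (suc k) bernoulliCoeff) p
      ∎
    where
    open ≈[]-Reasoning p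
    φ : ℕ → Carrier
    φ = shiftBy k bernoulliCoeff

  expCoeff-shiftBy-convolution : ∀ p m → m ≤ p →
    Σ< (suc p) (λ k → expCoeff k * shiftBy k bernoulliCoeff m) ≈ δ₀ m
  expCoeff-shiftBy-convolution p m m≤p = begin
    Σ< (suc p) f
      ≡⟨ P.cong (λ t → Σ< (suc t) f) (P.sym (ℕP.m+[n∸m]≡n m≤p)) ⟩
    Σ< (suc m +ℕ (p ∸ m)) f
      ≈⟨ Σ<-split (suc m) (p ∸ m) f ⟩
    Σ< (suc m) f + Σ< (p ∸ m) (λ i → f (suc m +ℕ i))
      ≈⟨ +-cong (Σ<-cong (suc m) unshifted) (Σ<-ε (p ∸ m) vanishing) ⟩
    Σ< (suc m) (λ k → expCoeff k * bernoulliCoeff (m ∸ k)) + 0#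
      ≈⟨ +-identityʳ _ ⟩
    Σ< (suc m) (λ k → expCoeff k * bernoulliCoeff (m ∸ k))
      ≈⟨ expCoeff-bernoulliCoeff-convolution m ⟩
    δ₀ m
      ∎
    where
    open ≈ᴷ-Reasoning
    f : ℕ → Carrier
    f k = expCoeff k * shiftBy k bernoulliCoeff m
    unshifted : ∀ k → k < suc m → f k ≈ expCoeff k * bernoulliCoeff (m ∸ k)
    unshifted k k<m+1 = *-congˡ (reflexive (shiftBy-≥ k m bernoulliCoeff (ℕP.≤-pred k<m+1)))
    vanishing : ∀ i → i < p ∸ m → f (suc m +ℕ i) ≈ 0#
    vanishing i _ =
      trans (*-congˡ (reflexive (shiftBy-< (suc m +ℕ i) m bernoulliCoeff (s≤s (ℕP.m≤m+n m i))))) (zeroʳ _)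

  expPartial-treeSum : ∀ p → expPartial (treeSum p) p ≈[ p ] x
  expPartial-treeSum p = begin
    expPartial (treeSum p) p
      ≈⟨ ≈ᴹ⇒≈[] (expPartial≈Σᴹ (treeSum p) p) ⟩
    Σᴹ (suc p) (λ k → expCoeff k *ₗ rightPower (treeSum p) k)
      ≈⟨ Σᴹ-≈[] (suc p) (λ k _ → ≈[]-*ₗ (expCoeff k) (rightPower-treeSum p k)) ⟩
    Σᴹ (suc p) (λ k → expCoeff k *ₗ weightedSum (shiftBy k bernoulliCoeff) p)
      ≈⟨ ≈ᴹ⇒≈[] (Σᴹ-cong′ (suc p) (λ k → ≈ᴹ-sym (weightedSum-* p (expCoeff k) (shiftBy k bernoulliCoeff)))) ⟩
    Σᴹ (suc p) (λ k → weightedSum (λ m → expCoeff k * shiftBy k bernoulliCoeff m) p)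
      ≈⟨ ≈ᴹ⇒≈[] (≈ᴹ-sym (weightedSum-Σ< p (suc p) (λ k m → expCoeff k * shiftBy k bernoulliCoeff m))) ⟩
    weightedSum (λ m → Σ< (suc p) (λ k → expCoeff k * shiftBy k bernoulliCoeff m)) p
      ≈⟨ ≈ᴹ⇒≈[] (weightedSum-cong p (λ m m<p → expCoeff-shiftBy-convolution p m (ℕP.<⇒≤ m<p))) ⟩
    weightedSum δ₀ p
      ≈⟨ weightedSum-recursion δ₀ p ⟩
    1# *ₗ x +ᴹ treeSum p ▷ weightedSum (λ _ → 0#) p
      ≈⟨ ≈ᴹ⇒≈[] (+ᴹ-cong (*ₗ-identityˡ x) (≈ᴹ-trans (▷-cong ≈ᴹ-refl (weightedSum-0 p)) (▷-zeroʳ _))) ⟩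
    x +ᴹ 0ᴹ
      ≈⟨ ≈ᴹ⇒≈[] (+ᴹ-identityʳ x) ⟩
    x ∎
    where open ≈[]-Reasoning p

  treeSeriesPartial≈treeSum : ∀ p → treeSeriesPartial x p ≈ᴹ treeSum p
  treeSeriesPartial≈treeSum zero    = ≈ᴹ-refl
  treeSeriesPartial≈treeSum (suc p) = begin
    sumᴹ (map treeTerm (treesUpTo p ++ treesOfSize (suc p)))
      ≡⟨ P.cong sumᴹ (LP.map-++ treeTerm (treesUpTo p) _) ⟩
    sumᴹ (map treeTerm (treesUpTo p) ++ map treeTerm (treesOfSize (suc p)))
      ≈⟨ sumᴹ-++ (map treeTerm (treesUpTo p)) _ ⟩
    treeSeriesPartial x p +ᴹ treePart (suc p)
      ≈⟨ +ᴹ-congʳ (treeSeriesPartial≈treeSum p) ⟩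
    treeSum (suc p)
      ∎
    where open ≈ᴹ-Reasoning

  treeSeries-stable : Stable (treeSeriesPartial x)
  treeSeries-stable {p} {n} p≤n = begin
    treeSeriesPartial x n  ≈⟨ ≈ᴹ⇒≈[] (treeSeriesPartial≈treeSum n) ⟩
    treeSum n              ≈⟨ partialSum-stable treePart-graded p≤n ⟩
    treeSum p              ≈⟨ ≈ᴹ⇒≈[] (≈ᴹ-sym (treeSeriesPartial≈treeSum p)) ⟩
    treeSeriesPartial x p  ∎
    where open ≈[]-Reasoning p

  limit-isLog : ∀ {l} → treeSeriesPartial x ⟶ l → IsLog x l
  limit-isLog {l} s⟶l = expPartial≈[]⇒isLog expPartial-l≈x
    where
    expPartial-l≈x : ∀ p → expPartial l p ≈[ p ] x
    expPartial-l≈x p = begin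
      expPartial l p            ≈⟨ expPartial-≈[] l≈treeSum p ⟩
      expPartial (treeSum p) p  ≈⟨ expPartial-treeSum p ⟩
      x                         ∎
      where
      open ≈[]-Reasoning p
      l≈treeSum : l ≈[ p ] treeSum p
      l≈treeSum = ≈[]-sym (≈[]-trans (≈ᴹ⇒≈[] (≈ᴹ-sym (treeSeriesPartial≈treeSum p))) (⟶-stable treeSeries-stable s⟶l p))

corollaryB3 : ∀ {c ℓ m ℓm ℓf : Level} (F : Field c ℓ) (ch0 : CharacteristicZero F)
                (M : Module (Field.commutativeRing F) m ℓm) (L : CompletePreLie F M ℓf)
                (x : Module.Carrierᴹ M) →
                let open PreLieOps F ch0 M L in
                ∃ (IsLog x) × (∀ y → IsLog x y → ConvergesTo (treeSeriesPartial x) y)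
corollaryB3 F ch0 M L x = (l , limit-isLog treeSeries⟶l) , treeSeries⟶log
  where
  open Module M using (Carrierᴹ)
  open CompletePreLie L using (complete)
  open PreLieOps F ch0 M L using (IsLog; treeSeriesPartial)
  open FilteredModule F M L
  open ExponentialSeries F ch0 M L using (isLog-unique)
  open TreeSeries F ch0 M L x using (treeSeries-stable; limit-isLog)
  limit : ∃ λ l → treeSeriesPartial x ⟶ l
  limit = complete (treeSeriesPartial x) (stable⇒cauchy treeSeries-stable)
  l : Carrierᴹ
  l = proj₁ limit
  treeSeries⟶l : treeSeriesPartial x ⟶ l
  treeSeries⟶l = proj₂ limit
  treeSeries⟶log : ∀ y → IsLog x y → treeSeriesPartial x ⟶ y
  treeSeries⟶log y log-y = stable-⟶ treeSeries-stable (λ p →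
    ≈[]-trans (⟶-stable treeSeries-stable treeSeries⟶l p) (isLog-unique (limit-isLog treeSeries⟶l) log-y p))
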